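{- Let $k$ be a finite field, let $D$ be an effective divisor on $\mathbf P^1_k$ of degree $r+1\ge 2$, and let $p\in k[x,y]$ be the unique monic homogeneous polynomial of degree $r+1$ with $\mathrm{Div}\,p=D$. Let $R_r$ denote the set of homogeneous polynomials of degree $r$ in $k[x,y]$. (1) If $\infty$ is not in the support of $D$ (so $y\nmid p$), then the set of degree-$r$ rational functions $F$ with $\Phi(F)=D$ equals $\{(xh-p)/(yh)\}$, where $h$ ranges over the monic polynomials in $R_r$ coprime to $yp$. (2) If $\infty$ is in the support of $D$ (so $y\mid p$), then the set of degree-$r$ rational functions $F$ with $\Phi(F)=D$ equals $\{(xh-cp)/(yh)\}$, where $h$ ranges over the monic polynomials in $R_r$ with $\gcd(h,p)=y$, and $c$ ranges over the elements of $k^\times$ with $cp\not\equiv xh \pmod{y^2}$.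
   Context: A homogeneous polynomial $f\in k[x,y]$ is monic if $f(x,1)$ is monic as a univariate polynomial. For a rational function $F\neq x/y$ on $\mathbf P^1_k$ of degree $s$, written $F=g/h$ with $g,h$ coprime homogeneous polynomials of degree $s$, its divisor of fixed points is $\Phi(F)=\mathrm{Div}(xh-yg)$, an effective divisor of degree $s+1$. The point $\infty$ is $(1:0)$. -}

module Defs where

open import Level using (Level; _⊔_)
open import Algebra.Bundles using (CommutativeRing)
open import Data.Nat as ℕ using (ℕ; zero; suc; _<_; _≟_)
open import Data.Fin using (Fin; toℕ)
open import Data.Vec using (Vec; []; _∷_; tabulate; map; zipWith)
open import Data.Product using (Σ; ∃; _×_; _,_)
open import Data.Sum using (_⊎_)
open import Data.Bool using (if_then_else_)
open import Relation.Nullary using (¬_)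
open import Relation.Nullary.Decidable using (⌊_⌋)
open import Relation.Binary using (Decidable)
open import Relation.Binary.PropositionalEquality using (_≡_)
open import Function.Bundles using (_⇔_)

record FiniteField (c ℓ : Level) : Set (Level.suc (c ⊔ ℓ)) where
  field
    commRing : CommutativeRing c ℓ
  open CommutativeRing commRing public hiding (ring; zero)
  field
    1≉0       : ¬ (1# ≈ 0#)
    inverse   : ∀ a → ¬ (a ≈ 0#) → ∃ λ b → a * b ≈ 1#
    _≟ₖ_      : Decidable _≈_
    card      : ℕ
    enum      : Fin card → Carrier
    enum-surj : ∀ a → ∃ λ i → enum i ≈ a

module HomPoly {c ℓ : Level} (𝕜 : FiniteField c ℓ) where
  open FiniteField 𝕜 public

  -- A homogeneous polynomial of degree d:  f = Σ_{i=0}^{d} a_i x^i y^(d-i),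
  -- stored as the vector (a_0 , … , a_d)  (index = exponent of x).
  HPoly : ℕ → Set c
  HPoly d = Vec Carrier (suc d)

  coeffV : ∀ {n} → Vec Carrier n → ℕ → Carrier
  coeffV []       _       = 0#
  coeffV (a ∷ v)  zero    = a
  coeffV (a ∷ v)  (suc i) = coeffV v i

  coeff : ∀ {d} → HPoly d → ℕ → Carrier
  coeff = coeffV

  coeff2 : ∀ {d} → HPoly d → ℕ → ℕ → Carrier
  coeff2 {d} f i j = if ⌊ i ℕ.+ j ≟ d ⌋ then coeff f i else 0#

  -- equality as elements of k[x,y] (makes sense across degrees)
  _≈ₚ_ : ∀ {d e} → HPoly d → HPoly e → Set ℓ
  f ≈ₚ g = ∀ i j → coeff2 f i j ≈ coeff2 g i j

  sumUpTo : (ℕ → Carrier) → ℕ → Carrier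
  sumUpTo s zero    = s zero
  sumUpTo s (suc n) = sumUpTo s n + s (suc n)

  _*ₚ_ : ∀ {d e} → HPoly d → HPoly e → HPoly (d ℕ.+ e)
  f *ₚ g = tabulate λ k → sumUpTo (λ i → coeff f i * coeff g (toℕ k ℕ.∸ i)) (toℕ k)

  _-ₚ_ : ∀ {d} → HPoly d → HPoly d → HPoly d
  f -ₚ g = zipWith (λ a b → a + (- b)) f g

  _·ₚ_ : ∀ {d} → Carrier → HPoly d → HPoly d
  c ·ₚ f = map (c *_) f

  one : HPoly 0
  one = 1# ∷ []

  X : HPoly 1
  X = 0# ∷ 1# ∷ []

  Y : HPoly 1
  Y = 1# ∷ 0# ∷ []

  pow : ∀ {e} → HPoly e → (n : ℕ) → HPoly (n ℕ.* e)
  pow f zero    = one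
  pow f (suc n) = f *ₚ pow f n

  _∣ₚ_ : ∀ {e d} → HPoly e → HPoly d → Set (c ⊔ ℓ)
  q ∣ₚ f = ∃ λ m → Σ (HPoly m) λ u → (q *ₚ u) ≈ₚ f

  -- f is monic:  f(x,1) = Σ a_i x^i  is monic
  Monic : ∀ {d} → HPoly d → Set ℓ
  Monic f = ∃ λ i → (coeff f i ≈ 1#) × (∀ j → i < j → coeff f j ≈ 0#)

  Coprime : ∀ {d e} → HPoly d → HPoly e → Set (c ⊔ ℓ)
  Coprime f g = ∀ m (q : HPoly m) → q ∣ₚ f → q ∣ₚ g → m ≡ 0

  IsGcd : ∀ {m d e} → HPoly m → HPoly d → HPoly e → Set (c ⊔ ℓ)
  IsGcd g a b = (g ∣ₚ a) × (g ∣ₚ b) × (∀ m (q : HPoly m) → q ∣ₚ a → q ∣ₚ b → q ∣ₚ g)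

  Irreducible : ∀ {e} → HPoly e → Set (c ⊔ ℓ)
  Irreducible {e} π = ¬ (e ≡ 0) × (∀ m (q : HPoly m) → q ∣ₚ π → (m ≡ 0) ⊎ (m ≡ e))

  -- closed points of P¹_k  ↔  monic irreducible homogeneous polynomials
  record ClosedPoint : Set (c ⊔ ℓ) where
    field
      deg   : ℕ
      poly  : HPoly deg
      monic : Monic poly
      irred : Irreducible poly

  -- Ord P f n :  the multiplicity of the closed point P in Div f is n
  Ord : ∀ {d} → ClosedPoint → HPoly d → ℕ → Set (c ⊔ ℓ)
  Ord P f n = (pow π n ∣ₚ f) × ¬ (pow π (suc n) ∣ₚ f)
    where π = ClosedPoint.poly P

  _≡Div_ : ∀ {d e} → HPoly d → HPoly e → Set (c ⊔ ℓ)
  f ≡Div g = ∀ P n → Ord P f n ⇔ Ord P g n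

  -- ∞ = (1:0) is in the support of Div f  (ord_∞ f ≥ 1, i.e. y ∣ f)
  ∞∈supp : ∀ {d} → HPoly d → Set (c ⊔ ℓ)
  ∞∈supp f = Y ∣ₚ f

  record RatFun (s : ℕ) : Set (c ⊔ ℓ) where
    constructor _/_∶_
    field
      num     : HPoly s
      den     : HPoly s
      coprime : Coprime num den

  _≈F_/_ : ∀ {s d} → RatFun s → HPoly d → HPoly d → Set ℓ
  F ≈F a / b = (RatFun.num F *ₚ b) ≈ₚ (a *ₚ RatFun.den F)

  IsXoverY : ∀ {s} → RatFun s → Set ℓ
  IsXoverY F = F ≈F X / Y

  -- Φ(F) = Div f   (Φ(F) = Div(xh - yg) for F = g/h ≠ x/y)
  FixDivIs : ∀ {s d} → RatFun s → HPoly d → Set (c ⊔ ℓ)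
  FixDivIs F f = ¬ IsXoverY F × ((X *ₚ RatFun.den F) -ₚ (Y *ₚ RatFun.num F)) ≡Div f

-- Write F = g/h and f = xh − yg for its fixed-point polynomial. If Φ(F) = Div p, every prime
-- power dividing p divides f, so p ∣ f by unique factorisation, and f = λp with λ ≠ 0 since both
-- have degree r + 1. Rescaling g and h by a constant turns this into xh − cp = yg with h monic,
-- i.e. F = (xh − cp)/(yh); comparing coefficients of x^(r+1) gives c = 1 when y ∤ p, and y ∣ h
-- when y ∣ p. Coprimality of g and h is then equivalent to the stated conditions on h and c.
-- Conversely, for such h and c, y divides xh − cp and the quotient g gives F = g/h.
-- Unique factorisation is obtained from Euclid's lemma, proved by division with remainder on
-- dehomogenisations f(x,1); finiteness of k makes divisibility decidable, which is what makes
-- the existence of irreducible factors constructive.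

module Submission where

open import Defs
open import Data.Nat using (ℕ; suc; _≤_)
open import Data.Product using (Σ; _×_)
open import Relation.Nullary using (¬_)

open import Level using (Level; _⊔_)
open import Algebra.Bundles using (CommutativeRing; Ring)
open import Data.Nat as N using (zero; z≤n; s≤s)
import Data.Nat.Properties as NP
open import Data.Nat.Induction using (<-rec)
open import Data.Fin using (Fin; toℕ)
import Data.Fin.Properties as FP
open import Data.Vec using (Vec; []; _∷_; tabulate; map; zipWith)
open import Data.Product using (_,_; proj₁; proj₂)
open import Data.Sum as Sum using (_⊎_; inj₁; inj₂; [_,_]′)
open import Data.Empty using (⊥; ⊥-elim)
open import Relation.Nullary using (Dec; yes; no)
open import Relation.Nullary.Decidable using (_×-dec_; map′)
import Relation.Binary.PropositionalEquality as P
open P using (_≡_)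
open import Relation.Binary.Definitions using (tri<; tri≈; tri>)
open import Function.Bundles using (_⇔_; mk⇔; Equivalence)
import Function.Properties.Equivalence as ⇔
open import Function using (id; _∘_)

module CoefficientSequences {c ℓ : Level} (𝕜 : FiniteField c ℓ) where
  open HomPoly 𝕜 public
  open import Relation.Binary.Reasoning.Setoid setoid
  open import Algebra.Properties.CommutativeSemigroup +-commutativeSemigroup using (interchange)
  open import Algebra.Properties.AbelianGroup +-abelianGroup using (⁻¹-∙-comm)
  open import Algebra.Properties.Group +-group using (x∙y⁻¹≈ε⇒x≈y; x≈y⇒x∙y⁻¹≈ε)
  open import Algebra.Properties.RingWithoutOne (Ring.ringWithoutOne (CommutativeRing.ring commRing)) using (-‿distribˡ-*)

  inv : (x : Carrier) → ¬ x ≈ 0# → Carrier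
  inv x x≉0 = proj₁ (inverse x x≉0)

  inv-inverseʳ : ∀ x x≉0 → x * inv x x≉0 ≈ 1#
  inv-inverseʳ x x≉0 = proj₂ (inverse x x≉0)

  inv-inverseˡ : ∀ x x≉0 → inv x x≉0 * x ≈ 1#
  inv-inverseˡ x x≉0 = trans (*-comm _ _) (inv-inverseʳ x x≉0)

  inv-cancelˡ : ∀ x x≉0 y → inv x x≉0 * (x * y) ≈ y
  inv-cancelˡ x x≉0 y = trans (sym (*-assoc _ _ _)) (trans (*-congʳ (inv-inverseˡ x x≉0)) (*-identityˡ y))

  inv-nonzero : ∀ x x≉0 → ¬ inv x x≉0 ≈ 0#
  inv-nonzero x x≉0 e = 1≉0 (trans (sym (inv-inverseʳ x x≉0)) (trans (*-congˡ e) (zeroʳ _)))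

  *-nonzero : ∀ {x y} → ¬ x ≈ 0# → ¬ y ≈ 0# → ¬ x * y ≈ 0#
  *-nonzero {x} {y} x≉0 y≉0 xy≈0 = y≉0 (begin
    y                  ≈⟨ inv-cancelˡ x x≉0 y ⟨
    inv x x≉0 * (x * y) ≈⟨ *-congˡ xy≈0 ⟩
    inv x x≉0 * 0#      ≈⟨ zeroʳ _ ⟩
    0#                 ∎)

  -- A polynomial f is handled through coeff f, the coefficient sequence of its dehomogenisation f(x,1).
  Seq : Set c
  Seq = ℕ → Carrier

  infix 4 _≐_
  _≐_ : Seq → Seq → Set ℓ
  a ≐ b = ∀ i → a i ≈ b i

  ≐-refl : ∀ {a} → a ≐ a
  ≐-refl i = refl

  ≐-sym : ∀ {a b} → a ≐ b → b ≐ a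
  ≐-sym p i = sym (p i)

  ≐-trans : ∀ {a b d} → a ≐ b → b ≐ d → a ≐ d
  ≐-trans p q i = trans (p i) (q i)

  Deg≤ : Seq → ℕ → Set ℓ
  Deg≤ a n = ∀ i → n N.< i → a i ≈ 0#

  𝟘 : Seq
  𝟘 _ = 0#

  infixl 6 _⊕_ _⊖_
  _⊕_ : Seq → Seq → Seq
  (a ⊕ b) i = a i + b i

  _⊖_ : Seq → Seq → Seq
  (a ⊖ b) i = a i + - b i

  negate : Seq → Seq
  negate a i = - a i

  scale : Carrier → Seq → Seq
  scale k a i = k * a i

  shift : Seq → Seq
  shift a zero    = 0#
  shift a (suc i) = a i

  tail : Seq → Seq
  tail a i = a (suc i)

  constant : Carrier → Seq
  constant k zero    = k
  constant k (suc i) = 0#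

  conv : Seq → Seq → Seq
  conv a b k = sumUpTo (λ i → a i * b (k N.∸ i)) k

  sumUpTo-cong : ∀ {s t} n → (∀ i → i N.≤ n → s i ≈ t i) → sumUpTo s n ≈ sumUpTo t n
  sumUpTo-cong zero    s≈t = s≈t 0 z≤n
  sumUpTo-cong (suc n) s≈t = +-cong (sumUpTo-cong n (λ i i≤n → s≈t i (NP.m≤n⇒m≤1+n i≤n))) (s≈t (suc n) NP.≤-refl)

  sumUpTo-zero : ∀ {s} n → (∀ i → i N.≤ n → s i ≈ 0#) → sumUpTo s n ≈ 0#
  sumUpTo-zero zero    s≈0 = s≈0 0 z≤n
  sumUpTo-zero (suc n) s≈0 =
    trans (+-cong (sumUpTo-zero n (λ i i≤n → s≈0 i (NP.m≤n⇒m≤1+n i≤n))) (s≈0 (suc n) NP.≤-refl)) (+-identityˡ 0#)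

  sumUpTo-+ : ∀ s t n → sumUpTo (λ i → s i + t i) n ≈ sumUpTo s n + sumUpTo t n
  sumUpTo-+ s t zero    = refl
  sumUpTo-+ s t (suc n) = trans (+-congʳ (sumUpTo-+ s t n)) (interchange _ _ _ _)

  sumUpTo-*ˡ : ∀ k s n → sumUpTo (λ i → k * s i) n ≈ k * sumUpTo s n
  sumUpTo-*ˡ k s zero    = refl
  sumUpTo-*ˡ k s (suc n) = trans (+-congʳ (sumUpTo-*ˡ k s n)) (sym (distribˡ k _ _))

  sumUpTo-neg : ∀ s n → sumUpTo (λ i → - s i) n ≈ - sumUpTo s n
  sumUpTo-neg s zero    = refl
  sumUpTo-neg s (suc n) = trans (+-congʳ (sumUpTo-neg s n)) (⁻¹-∙-comm (sumUpTo s n) (s (suc n)))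

  sumUpTo-head : ∀ s n → sumUpTo s (suc n) ≈ s 0 + sumUpTo (λ i → s (suc i)) n
  sumUpTo-head s zero    = refl
  sumUpTo-head s (suc n) = trans (+-congʳ (sumUpTo-head s n)) (+-assoc _ _ _)

  sumUpTo-reverse : ∀ s n → sumUpTo s n ≈ sumUpTo (λ i → s (n N.∸ i)) n
  sumUpTo-reverse s zero    = refl
  sumUpTo-reverse s (suc n) = begin
    sumUpTo s n + s (suc n)                   ≈⟨ +-congʳ (sumUpTo-reverse s n) ⟩
    sumUpTo (λ i → s (n N.∸ i)) n + s (suc n) ≈⟨ +-comm _ _ ⟩
    s (suc n) + sumUpTo (λ i → s (n N.∸ i)) n ≈⟨ sumUpTo-head (λ i → s (suc n N.∸ i)) n ⟨
    sumUpTo (λ i → s (suc n N.∸ i)) (suc n)   ∎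

  sumUpTo-single : ∀ {s} n k → k N.≤ n → (∀ i → i N.≤ n → ¬ i ≡ k → s i ≈ 0#) → sumUpTo s n ≈ s k
  sumUpTo-single zero    .zero z≤n  _   = refl
  sumUpTo-single (suc n) k     k≤1+n s≈0 with k N.≟ suc n
  ... | yes P.refl =
    trans (+-congʳ (sumUpTo-zero n (λ i i≤n → s≈0 i (NP.m≤n⇒m≤1+n i≤n) (NP.<⇒≢ (s≤s i≤n))))) (+-identityˡ _)
  ... | no  k≢1+n  =
    trans (+-cong (sumUpTo-single n k (NP.≤-pred (NP.≤∧≢⇒< k≤1+n k≢1+n)) (λ i i≤n → s≈0 i (NP.m≤n⇒m≤1+n i≤n)))
                  (s≈0 (suc n) NP.≤-refl (λ e → k≢1+n (P.sym e))))
          (+-identityʳ _)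

  conv-cong : ∀ {a a' b b'} → a ≐ a' → b ≐ b' → conv a b ≐ conv a' b'
  conv-cong a≐a' b≐b' k = sumUpTo-cong k (λ i _ → *-cong (a≐a' i) (b≐b' (k N.∸ i)))

  conv-congˡ : ∀ {a a'} b → a ≐ a' → conv a b ≐ conv a' b
  conv-congˡ b a≐a' = conv-cong {b = b} {b' = b} a≐a' ≐-refl

  conv-congʳ : ∀ a {b b'} → b ≐ b' → conv a b ≐ conv a b'
  conv-congʳ a b≐b' = conv-cong {a = a} {a' = a} ≐-refl b≐b'

  conv-comm : ∀ a b → conv a b ≐ conv b a
  conv-comm a b k = begin
    sumUpTo (λ i → a i * b (k N.∸ i)) k                 ≈⟨ sumUpTo-reverse _ k ⟩
    sumUpTo (λ i → a (k N.∸ i) * b (k N.∸ (k N.∸ i))) k ≈⟨ sumUpTo-cong k swap ⟩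
    sumUpTo (λ i → b i * a (k N.∸ i)) k                 ∎
    where
    swap : ∀ i → i N.≤ k → a (k N.∸ i) * b (k N.∸ (k N.∸ i)) ≈ b i * a (k N.∸ i)
    swap i i≤k = trans (*-comm _ _) (*-congʳ (reflexive (P.cong b (NP.m∸[m∸n]≡n i≤k))))

  conv-distribʳ-⊕ : ∀ a b d → conv (a ⊕ b) d ≐ conv a d ⊕ conv b d
  conv-distribʳ-⊕ a b d k = trans (sumUpTo-cong k (λ i _ → distribʳ _ _ _)) (sumUpTo-+ _ _ k)

  conv-negateˡ : ∀ a b → conv (negate a) b ≐ negate (conv a b)
  conv-negateˡ a b k = trans (sumUpTo-cong k (λ i _ → sym (-‿distribˡ-* _ _))) (sumUpTo-neg _ k)

  conv-distribʳ-⊖ : ∀ a b d → conv (a ⊖ b) d ≐ conv a d ⊖ conv b d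
  conv-distribʳ-⊖ a b d k = trans (conv-distribʳ-⊕ a (negate b) d k) (+-congˡ (conv-negateˡ b d k))

  conv-distribˡ-⊕ : ∀ a b d → conv d (a ⊕ b) ≐ conv d a ⊕ conv d b
  conv-distribˡ-⊕ a b d k =
    trans (conv-comm d _ k) (trans (conv-distribʳ-⊕ a b d k) (+-cong (conv-comm a d k) (conv-comm b d k)))

  conv-distribˡ-⊖ : ∀ a b d → conv d (a ⊖ b) ≐ conv d a ⊖ conv d b
  conv-distribˡ-⊖ a b d k =
    trans (conv-comm d _ k) (trans (conv-distribʳ-⊖ a b d k) (+-cong (conv-comm a d k) (-‿cong (conv-comm b d k))))

  conv-scaleˡ : ∀ x a b → conv (scale x a) b ≐ scale x (conv a b)
  conv-scaleˡ x a b k = trans (sumUpTo-cong k (λ i _ → *-assoc _ _ _)) (sumUpTo-*ˡ x _ k)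

  conv-scaleʳ : ∀ x a b → conv a (scale x b) ≐ scale x (conv a b)
  conv-scaleʳ x a b k = trans (conv-comm a _ k) (trans (conv-scaleˡ x b a k) (*-congˡ (conv-comm b a k)))

  conv-constantˡ : ∀ x b → conv (constant x) b ≐ scale x b
  conv-constantˡ x b zero    = refl
  conv-constantˡ x b (suc k) = trans (sumUpTo-head _ k) (trans (+-congˡ (sumUpTo-zero k (λ i _ → zeroˡ _))) (+-identityʳ _))

  conv-constantʳ : ∀ x b → conv b (constant x) ≐ scale x b
  conv-constantʳ x b = ≐-trans (conv-comm b _) (conv-constantˡ x b)

  conv-identityˡ : ∀ a → conv (constant 1#) a ≐ a
  conv-identityˡ a i = trans (conv-constantˡ 1# a i) (*-identityˡ _)

  conv-identityʳ : ∀ a → conv a (constant 1#) ≐ a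
  conv-identityʳ a = ≐-trans (conv-comm a _) (conv-identityˡ a)

  conv-shiftˡ : ∀ a b → conv (shift a) b ≐ shift (conv a b)
  conv-shiftˡ a b zero    = zeroˡ _
  conv-shiftˡ a b (suc k) = trans (sumUpTo-head _ k) (trans (+-congʳ (zeroˡ _)) (+-identityˡ _))

  conv-zeroˡ : ∀ b → conv 𝟘 b ≐ 𝟘
  conv-zeroˡ b k = sumUpTo-zero k (λ i _ → zeroˡ _)

  conv-zeroʳ : ∀ b → conv b 𝟘 ≐ 𝟘
  conv-zeroʳ b k = sumUpTo-zero k (λ i _ → zeroʳ _)

  constant⊕shift-tail : ∀ a → a ≐ constant (a 0) ⊕ shift (tail a)
  constant⊕shift-tail a zero    = sym (+-identityʳ _)
  constant⊕shift-tail a (suc i) = sym (+-identityˡ _)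

  conv-unfoldˡ : ∀ a b → conv a b ≐ scale (a 0) b ⊕ shift (conv (tail a) b)
  conv-unfoldˡ a b = ≐-trans (conv-congˡ b (constant⊕shift-tail a))
    (λ k → trans (conv-distribʳ-⊕ _ _ b k) (+-cong (conv-constantˡ _ b k) (conv-shiftˡ _ b k)))

  conv-assoc : ∀ a b d → conv (conv a b) d ≐ conv a (conv b d)
  conv-assoc a b d k = begin
    conv (conv a b) d k                                                 ≈⟨ conv-congˡ d (conv-unfoldˡ a b) k ⟩
    conv (scale (a 0) b ⊕ shift (conv (tail a) b)) d k                  ≈⟨ conv-distribʳ-⊕ _ _ d k ⟩
    conv (scale (a 0) b) d k + conv (shift (conv (tail a) b)) d k       ≈⟨ +-cong (conv-scaleˡ _ b d k) (conv-shiftˡ _ d k) ⟩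
    scale (a 0) (conv b d) k + shift (conv (conv (tail a) b) d) k       ≈⟨ +-congˡ (shift-assoc k) ⟩
    scale (a 0) (conv b d) k + shift (conv (tail a) (conv b d)) k       ≈⟨ conv-unfoldˡ a (conv b d) k ⟨
    conv a (conv b d) k                                                 ∎
    where
    shift-assoc : shift (conv (conv (tail a) b) d) ≐ shift (conv (tail a) (conv b d))
    shift-assoc zero    = refl
    shift-assoc (suc k) = conv-assoc (tail a) b d k

  Deg≤-mono : ∀ {a m n} → m N.≤ n → Deg≤ a m → Deg≤ a n
  Deg≤-mono m≤n a≤m i n<i = a≤m i (NP.≤-<-trans m≤n n<i)

  Deg≤-pred : ∀ {a n} → Deg≤ a (suc n) → a (suc n) ≈ 0# → Deg≤ a n
  Deg≤-pred a≤1+n top≈0 i n<i with NP.m≤n⇒m<n∨m≡n n<i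
  ... | inj₁ 1+n<i  = a≤1+n i 1+n<i
  ... | inj₂ P.refl = top≈0

  Deg≤0⇒constant : ∀ {a} → Deg≤ a 0 → a ≐ constant (a 0)
  Deg≤0⇒constant a≤0 zero    = refl
  Deg≤0⇒constant a≤0 (suc i) = a≤0 (suc i) (s≤s z≤n)

  Deg≤0⇒≐𝟘 : ∀ {a} → Deg≤ a 0 → a 0 ≈ 0# → a ≐ 𝟘
  Deg≤0⇒≐𝟘 a≤0 a0≈0 zero    = a0≈0
  Deg≤0⇒≐𝟘 a≤0 a0≈0 (suc i) = a≤0 (suc i) (s≤s z≤n)

  Deg≤-⊕ : ∀ {a b n} → Deg≤ a n → Deg≤ b n → Deg≤ (a ⊕ b) n
  Deg≤-⊕ a≤n b≤n i n<i = trans (+-cong (a≤n i n<i) (b≤n i n<i)) (+-identityʳ _)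

  Deg≤-⊖ : ∀ {a b n} → Deg≤ a n → Deg≤ b n → Deg≤ (a ⊖ b) n
  Deg≤-⊖ a≤n b≤n i n<i = trans (+-cong (a≤n i n<i) (trans (-‿cong (b≤n i n<i)) -0≈0)) (+-identityʳ _)
    where open import Algebra.Properties.Ring (CommutativeRing.ring commRing) renaming (-0#≈0# to -0≈0)

  Deg≤-scale : ∀ {a n} x → Deg≤ a n → Deg≤ (scale x a) n
  Deg≤-scale x a≤n i n<i = trans (*-congˡ (a≤n i n<i)) (zeroʳ _)

  Deg≤-𝟘 : ∀ {n} → Deg≤ 𝟘 n
  Deg≤-𝟘 i _ = refl

  conv-vanishing-term : ∀ {a b} m n k i → Deg≤ a m → Deg≤ b n → m N.+ n N.< i N.+ (k N.∸ i) → a i * b (k N.∸ i) ≈ 0#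
  conv-vanishing-term {a} {b} m n k i a≤m b≤n lt with i N.≤? m
  ... | yes i≤m = trans (*-congˡ (b≤n _ (NP.+-cancelˡ-< i n (k N.∸ i) (NP.≤-<-trans (NP.+-monoˡ-≤ n i≤m) lt)))) (zeroʳ _)
  ... | no  i≰m = trans (*-congʳ (a≤m i (NP.≰⇒> i≰m))) (zeroˡ _)

  conv-Deg≤ : ∀ {a b} m n → Deg≤ a m → Deg≤ b n → Deg≤ (conv a b) (m N.+ n)
  conv-Deg≤ m n a≤m b≤n k m+n<k = sumUpTo-zero k (λ i i≤k →
    conv-vanishing-term m n k i a≤m b≤n (P.subst (m N.+ n N.<_) (P.sym (NP.m+[n∸m]≡n i≤k)) m+n<k))

  conv-top : ∀ {a b} m n → Deg≤ a m → Deg≤ b n → conv a b (m N.+ n) ≈ a m * b n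
  conv-top {a} {b} m n a≤m b≤n = trans (sumUpTo-single (m N.+ n) m (NP.m≤m+n m n) off-diagonal)
                                       (*-congˡ (reflexive (P.cong b (NP.m+n∸m≡n m n))))
    where
    off-diagonal : ∀ i → i N.≤ m N.+ n → ¬ i ≡ m → a i * b (m N.+ n N.∸ i) ≈ 0#
    off-diagonal i i≤m+n i≢m with i N.≤? m
    ... | no  i≰m = trans (*-congʳ (a≤m i (NP.≰⇒> i≰m))) (zeroˡ _)
    ... | yes i≤m = trans (*-congˡ (b≤n _ (NP.+-cancelˡ-< i n _ lt))) (zeroʳ _)
      where lt = P.subst (i N.+ n N.<_) (P.sym (NP.m+[n∸m]≡n i≤m+n)) (NP.+-monoˡ-< n (NP.≤∧≢⇒< i≤m i≢m))

  HasDegree : Seq → Set ℓ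
  HasDegree a = Σ ℕ λ k → (¬ a k ≈ 0#) × Deg≤ a k

  degree? : ∀ n a → Deg≤ a n → (a ≐ 𝟘) ⊎ HasDegree a
  degree? zero a a≤0 with a 0 ≟ₖ 0#
  ... | yes a0≈0 = inj₁ (Deg≤0⇒≐𝟘 a≤0 a0≈0)
  ... | no  a0≉0 = inj₂ (0 , a0≉0 , a≤0)
  degree? (suc n) a a≤1+n with a (suc n) ≟ₖ 0#
  ... | no  top≉0 = inj₂ (suc n , top≉0 , a≤1+n)
  ... | yes top≈0 = degree? n a (Deg≤-pred a≤1+n top≈0)

  HasDegree⇒≉𝟘 : ∀ {a} → HasDegree a → ¬ (a ≐ 𝟘)
  HasDegree⇒≉𝟘 (k , ak≉0 , _) a≐𝟘 = ak≉0 (a≐𝟘 k)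

  conv-HasDegree : ∀ {a b} → HasDegree a → HasDegree b → HasDegree (conv a b)
  conv-HasDegree (m , am≉0 , a≤m) (n , bn≉0 , b≤n) =
    m N.+ n , (λ top≈0 → *-nonzero am≉0 bn≉0 (trans (sym (conv-top m n a≤m b≤n)) top≈0)) , conv-Deg≤ m n a≤m b≤n

  conv-cancel-𝟘 : ∀ {a b} n → Deg≤ b n → HasDegree a → conv a b ≐ 𝟘 → b ≐ 𝟘
  conv-cancel-𝟘 n b≤n deg-a ab≐𝟘 with degree? n _ b≤n
  ... | inj₁ b≐𝟘   = b≐𝟘
  ... | inj₂ deg-b = ⊥-elim (HasDegree⇒≉𝟘 (conv-HasDegree deg-a deg-b) ab≐𝟘)

  quotient-Deg≤ : ∀ {π u w} e d → Deg≤ π e → ¬ π e ≈ 0# → (u ≐ 𝟘) ⊎ HasDegree u → Deg≤ w d →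
                  conv π u ≐ w → Deg≤ u (d N.∸ e) × (¬ (w ≐ 𝟘) → e N.≤ d)
  quotient-Deg≤ {π} {u} {w} e d π≤e πe≉0 (inj₁ u≐𝟘) w≤d πu≐w =
    (λ i _ → u≐𝟘 i) ,
    λ w≉𝟘 → ⊥-elim (w≉𝟘 (≐-trans (≐-sym πu≐w) (≐-trans (conv-congʳ π u≐𝟘) (conv-zeroʳ π))))
  quotient-Deg≤ {π} {u} {w} e d π≤e πe≉0 (inj₂ (k , uk≉0 , u≤k)) w≤d πu≐w =
    Deg≤-mono (NP.m+n≤o⇒m≤o∸n k (P.subst (N._≤ d) (NP.+-comm e k) e+k≤d)) u≤k ,
    λ _ → NP.≤-trans (NP.m≤m+n e k) e+k≤d
    where
    e+k≤d : e N.+ k N.≤ d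
    e+k≤d with e N.+ k N.≤? d
    ... | yes e+k≤d = e+k≤d
    ... | no  e+k≰d =
      ⊥-elim (*-nonzero πe≉0 uk≉0 (trans (sym (conv-top e k π≤e u≤k)) (trans (πu≐w _) (w≤d _ (NP.≰⇒> e+k≰d)))))

  conv-cancelˡ : ∀ {r x y} n → HasDegree r → Deg≤ x n → Deg≤ y n → conv r x ≐ conv r y → x ≐ y
  conv-cancelˡ {r} {x} {y} n deg-r x≤n y≤n rx≐ry i =
    x∙y⁻¹≈ε⇒x≈y (x i) (y i) (conv-cancel-𝟘 n (Deg≤-⊖ x≤n y≤n) deg-r r[x-y]≐𝟘 i)
    where
    r[x-y]≐𝟘 : conv r (x ⊖ y) ≐ 𝟘
    r[x-y]≐𝟘 k = trans (conv-distribˡ-⊖ x y r k) (x≈y⇒x∙y⁻¹≈ε (rx≐ry k))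

module PolynomialCoefficients {c ℓ : Level} (𝕜 : FiniteField c ℓ) where
  open CoefficientSequences 𝕜 public
  open import Algebra.Properties.Ring (CommutativeRing.ring commRing) using (-0#≈0#)

  coeffV-beyond : ∀ {n} (v : Vec Carrier n) i → n N.≤ i → coeffV v i ≡ 0#
  coeffV-beyond []      i       _         = P.refl
  coeffV-beyond (x ∷ v) (suc i) (s≤s n≤i) = coeffV-beyond v i n≤i

  coeff-Deg≤ : ∀ {d} (f : HPoly d) → Deg≤ (coeff f) d
  coeff-Deg≤ f i d<i = reflexive (coeffV-beyond f i d<i)

  coeffV-tabulate : ∀ n (a : Seq) i → i N.< n → coeffV (tabulate {n = n} (λ k → a (toℕ k))) i ≡ a i
  coeffV-tabulate (suc n) a zero    _         = P.refl
  coeffV-tabulate (suc n) a (suc i) (s≤s i<n) = coeffV-tabulate n (λ j → a (suc j)) i i<n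

  fromSeq : (d : ℕ) → Seq → HPoly d
  fromSeq d a = tabulate (λ k → a (toℕ k))

  coeff-fromSeq : ∀ {d a} → Deg≤ a d → coeff (fromSeq d a) ≐ a
  coeff-fromSeq {d} {a} a≤d i with i N.<? suc d
  ... | yes i≤d = reflexive (coeffV-tabulate (suc d) a i i≤d)
  ... | no  i≰d = trans (reflexive (coeffV-beyond (fromSeq d a) i (NP.≮⇒≥ i≰d))) (sym (a≤d i (NP.≮⇒≥ i≰d)))

  coeff-* : ∀ {d e} (f : HPoly d) (g : HPoly e) → coeff (f *ₚ g) ≐ conv (coeff f) (coeff g)
  coeff-* {d} {e} f g = coeff-fromSeq (conv-Deg≤ d e (coeff-Deg≤ f) (coeff-Deg≤ g))

  coeffV-zipWith : ∀ {n} (u v : Vec Carrier n) → coeffV (zipWith (λ a b → a + - b) u v) ≐ coeffV u ⊖ coeffV v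
  coeffV-zipWith []      []      i       = sym (trans (+-congˡ -0#≈0#) (+-identityʳ 0#))
  coeffV-zipWith (x ∷ u) (y ∷ v) zero    = refl
  coeffV-zipWith (x ∷ u) (y ∷ v) (suc i) = coeffV-zipWith u v i

  coeff-sub : ∀ {d} (f g : HPoly d) → coeff (f -ₚ g) ≐ coeff f ⊖ coeff g
  coeff-sub = coeffV-zipWith

  coeffV-map : ∀ {n} x (v : Vec Carrier n) → coeffV (map (x *_) v) ≐ scale x (coeffV v)
  coeffV-map x []      i       = sym (zeroʳ x)
  coeffV-map x (y ∷ v) zero    = refl
  coeffV-map x (y ∷ v) (suc i) = coeffV-map x v i

  coeff-· : ∀ {d} x (f : HPoly d) → coeff (x ·ₚ f) ≐ scale x (coeff f)
  coeff-· = coeffV-map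

  coeff-one : coeff one ≐ constant 1#
  coeff-one zero    = refl
  coeff-one (suc i) = refl

  coeff-Y : coeff Y ≐ constant 1#
  coeff-Y zero          = refl
  coeff-Y (suc zero)    = refl
  coeff-Y (suc (suc i)) = refl

  coeff-X : coeff X ≐ shift (constant 1#)
  coeff-X zero          = refl
  coeff-X (suc zero)    = refl
  coeff-X (suc (suc i)) = refl

  coeff-Y* : ∀ {d} (g : HPoly d) → coeff (Y *ₚ g) ≐ coeff g
  coeff-Y* g = ≐-trans (coeff-* Y g) (≐-trans (conv-congˡ (coeff g) coeff-Y) (conv-identityˡ (coeff g)))

  coeff-*Y : ∀ {d} (g : HPoly d) → coeff (g *ₚ Y) ≐ coeff g
  coeff-*Y g = ≐-trans (coeff-* g Y) (≐-trans (conv-congʳ (coeff g) coeff-Y) (conv-identityʳ (coeff g)))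

  coeff-X* : ∀ {d} (h : HPoly d) → coeff (X *ₚ h) ≐ shift (coeff h)
  coeff-X* h = ≐-trans (coeff-* X h) (≐-trans (conv-congˡ (coeff h) coeff-X) (≐-trans (conv-shiftˡ _ (coeff h)) shift-identity))
    where
    shift-identity : shift (conv (constant 1#) (coeff h)) ≐ shift (coeff h)
    shift-identity zero    = refl
    shift-identity (suc i) = conv-identityˡ (coeff h) i

  coeff2-diagonal : ∀ {d} (f : HPoly d) i j → i N.+ j ≡ d → coeff2 f i j ≈ coeff f i
  coeff2-diagonal {d} f i j i+j≡d with i N.+ j N.≟ d
  ... | yes _     = refl
  ... | no  i+j≢d = ⊥-elim (i+j≢d i+j≡d)

  coeff2-offDiagonal : ∀ {d} (f : HPoly d) i j → ¬ i N.+ j ≡ d → coeff2 f i j ≈ 0#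
  coeff2-offDiagonal {d} f i j i+j≢d with i N.+ j N.≟ d
  ... | yes i+j≡d = ⊥-elim (i+j≢d i+j≡d)
  ... | no  _     = refl

  coeff≈coeff2 : ∀ {d} (f : HPoly d) i → i N.≤ d → coeff f i ≈ coeff2 f i (d N.∸ i)
  coeff≈coeff2 f i i≤d = sym (coeff2-diagonal f i _ (NP.m+[n∸m]≡n i≤d))

  ≈ₚ⇒other-degree⇒≈0 : ∀ {d e} (f : HPoly d) (g : HPoly e) → f ≈ₚ g → ¬ d ≡ e → ∀ i → coeff f i ≈ 0#
  ≈ₚ⇒other-degree⇒≈0 {d} f g f≈g d≢e i with i N.≤? d
  ... | no  i≰d = coeff-Deg≤ f i (NP.≰⇒> i≰d)
  ... | yes i≤d = trans (coeff≈coeff2 f i i≤d)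
                        (trans (f≈g i _) (coeff2-offDiagonal g i _ (λ e → d≢e (P.trans (P.sym (NP.m+[n∸m]≡n i≤d)) e))))

  ≈ₚ-degree : ∀ {d e} (f : HPoly d) (g : HPoly e) → f ≈ₚ g → (d ≡ e) ⊎ (coeff f ≐ 𝟘)
  ≈ₚ-degree {d} {e} f g f≈g with d N.≟ e
  ... | yes d≡e = inj₁ d≡e
  ... | no  d≢e = inj₂ (≈ₚ⇒other-degree⇒≈0 f g f≈g d≢e)

  ≈ₚ⇒≐ : ∀ {d e} (f : HPoly d) (g : HPoly e) → f ≈ₚ g → coeff f ≐ coeff g
  ≈ₚ⇒≐ {d} {e} f g f≈g i with d N.≟ e
  ... | no d≢e = trans (≈ₚ⇒other-degree⇒≈0 f g f≈g d≢e i)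
                       (sym (≈ₚ⇒other-degree⇒≈0 g f (λ i j → sym (f≈g i j)) (λ e → d≢e (P.sym e)) i))
  ... | yes P.refl with i N.≤? d
  ...   | yes i≤d = trans (coeff≈coeff2 f i i≤d) (trans (f≈g i _) (sym (coeff≈coeff2 g i i≤d)))
  ...   | no  i≰d = trans (coeff-Deg≤ f i (NP.≰⇒> i≰d)) (sym (coeff-Deg≤ g i (NP.≰⇒> i≰d)))

  ≐⇒≈ₚ : ∀ {d e} (f : HPoly d) (g : HPoly e) → d ≡ e → coeff f ≐ coeff g → f ≈ₚ g
  ≐⇒≈ₚ {d} f g P.refl f≐g i j with i N.+ j N.≟ d
  ... | yes _ = f≐g i
  ... | no  _ = refl

  𝟘⇒≈ₚ : ∀ {d e} (f : HPoly d) (g : HPoly e) → coeff f ≐ 𝟘 → coeff g ≐ 𝟘 → f ≈ₚ g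
  𝟘⇒≈ₚ f g f≐𝟘 g≐𝟘 i j = trans (coeff2≈0 f (f≐𝟘 i)) (sym (coeff2≈0 g (g≐𝟘 i)))
    where
    coeff2≈0 : ∀ {d} (f : HPoly d) → coeff f i ≈ 0# → coeff2 f i j ≈ 0#
    coeff2≈0 {d} f fi≈0 with i N.+ j N.≟ d
    ... | yes _ = fi≈0
    ... | no  _ = refl

module Divisibility {c ℓ : Level} (𝕜 : FiniteField c ℓ) where
  open PolynomialCoefficients 𝕜 public
  open import Relation.Binary.Reasoning.Setoid setoid

  -- Single-field records around _≈ₚ_ and _∣ₚ_: unlike those function types,
  -- they let Agda infer the polynomials from a proof.
  infix 4 _≋_ _∣_
  record _≋_ {d e} (f : HPoly d) (g : HPoly e) : Set ℓ where
    constructor mk≋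
    field un≋ : f ≈ₚ g
  open _≋_ public

  record _∣_ {e d} (q : HPoly e) (f : HPoly d) : Set (c ⊔ ℓ) where
    constructor mk∣
    field un∣ : q ∣ₚ f
  open _∣_ public

  ≋-refl : ∀ {d} {f : HPoly d} → f ≋ f
  ≋-refl = mk≋ (λ i j → refl)

  ≋-sym : ∀ {d e} {f : HPoly d} {g : HPoly e} → f ≋ g → g ≋ f
  ≋-sym (mk≋ f≈g) = mk≋ (λ i j → sym (f≈g i j))

  ≋-trans : ∀ {d e k} {f : HPoly d} {g : HPoly e} {h : HPoly k} → f ≋ g → g ≋ h → f ≋ h
  ≋-trans (mk≋ f≈g) (mk≋ g≈h) = mk≋ (λ i j → trans (f≈g i j) (g≈h i j))

  ≋-byCoeff : ∀ {d e} {f : HPoly d} {g : HPoly e} → d ≡ e → coeff f ≐ coeff g → f ≋ g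
  ≋-byCoeff {f = f} {g} d≡e f≐g = mk≋ (≐⇒≈ₚ f g d≡e f≐g)

  ≋-𝟘 : ∀ {d e} {f : HPoly d} {g : HPoly e} → coeff f ≐ 𝟘 → coeff g ≐ 𝟘 → f ≋ g
  ≋-𝟘 {f = f} {g} f≐𝟘 g≐𝟘 = mk≋ (𝟘⇒≈ₚ f g f≐𝟘 g≐𝟘)

  ≋⇒≐ : ∀ {d e} {f : HPoly d} {g : HPoly e} → f ≋ g → coeff f ≐ coeff g
  ≋⇒≐ {f = f} {g} (mk≋ f≈g) = ≈ₚ⇒≐ f g f≈g

  ≋-degree : ∀ {d e} {f : HPoly d} {g : HPoly e} → f ≋ g → (d ≡ e) ⊎ (coeff f ≐ 𝟘)
  ≋-degree {f = f} {g} (mk≋ f≈g) = ≈ₚ-degree f g f≈g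

  *ₚ-zeroˡ : ∀ {d e} (a : HPoly d) (b : HPoly e) → coeff a ≐ 𝟘 → coeff (a *ₚ b) ≐ 𝟘
  *ₚ-zeroˡ a b a≐𝟘 = ≐-trans (coeff-* a b) (≐-trans (conv-congˡ (coeff b) a≐𝟘) (conv-zeroˡ (coeff b)))

  *ₚ-zeroʳ : ∀ {d e} (a : HPoly d) (b : HPoly e) → coeff b ≐ 𝟘 → coeff (a *ₚ b) ≐ 𝟘
  *ₚ-zeroʳ a b b≐𝟘 = ≐-trans (coeff-* a b) (≐-trans (conv-congʳ (coeff a) b≐𝟘) (conv-zeroʳ (coeff a)))

  *ₚ-cong : ∀ {d d' e e'} {a : HPoly d} {a' : HPoly d'} {b : HPoly e} {b' : HPoly e'} → a ≋ a' → b ≋ b' → (a *ₚ b) ≋ (a' *ₚ b')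
  *ₚ-cong {a = a} {a'} {b} {b'} a≋a' b≋b' with ≋-degree a≋a' | ≋-degree b≋b'
  ... | inj₁ d≡d' | inj₁ e≡e' = ≋-byCoeff (P.cong₂ N._+_ d≡d' e≡e')
          (≐-trans (coeff-* a b) (≐-trans (conv-cong (≋⇒≐ a≋a') (≋⇒≐ b≋b')) (≐-sym (coeff-* a' b'))))
  ... | inj₂ a≐𝟘 | _ = ≋-𝟘 (*ₚ-zeroˡ a b a≐𝟘) (*ₚ-zeroˡ a' b' (≐-trans (≐-sym (≋⇒≐ a≋a')) a≐𝟘))
  ... | _ | inj₂ b≐𝟘 = ≋-𝟘 (*ₚ-zeroʳ a b b≐𝟘) (*ₚ-zeroʳ a' b' (≐-trans (≐-sym (≋⇒≐ b≋b')) b≐𝟘))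

  *ₚ-comm : ∀ {d e} (a : HPoly d) (b : HPoly e) → (a *ₚ b) ≋ (b *ₚ a)
  *ₚ-comm {d} {e} a b = ≋-byCoeff (NP.+-comm d e)
    (≐-trans (coeff-* a b) (≐-trans (conv-comm (coeff a) (coeff b)) (≐-sym (coeff-* b a))))

  *ₚ-assoc : ∀ {d e k} (a : HPoly d) (b : HPoly e) (h : HPoly k) → ((a *ₚ b) *ₚ h) ≋ (a *ₚ (b *ₚ h))
  *ₚ-assoc {d} {e} {k} a b h = ≋-byCoeff (NP.+-assoc d e k) λ i → begin
    coeff ((a *ₚ b) *ₚ h) i                ≈⟨ coeff-* (a *ₚ b) h i ⟩
    conv (coeff (a *ₚ b)) (coeff h) i      ≈⟨ conv-congˡ (coeff h) (coeff-* a b) i ⟩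
    conv (conv (coeff a) (coeff b)) (coeff h) i ≈⟨ conv-assoc (coeff a) (coeff b) (coeff h) i ⟩
    conv (coeff a) (conv (coeff b) (coeff h)) i ≈⟨ conv-congʳ (coeff a) (coeff-* b h) i ⟨
    conv (coeff a) (coeff (b *ₚ h)) i      ≈⟨ coeff-* a (b *ₚ h) i ⟨
    coeff (a *ₚ (b *ₚ h)) i                ∎

  *ₚ-swap : ∀ {a b k} (x : HPoly a) (y : HPoly b) (z : HPoly k) → (x *ₚ (y *ₚ z)) ≋ (y *ₚ (x *ₚ z))
  *ₚ-swap x y z = ≋-trans (≋-sym (*ₚ-assoc x y z)) (≋-trans (*ₚ-cong (*ₚ-comm x y) (≋-refl {f = z})) (*ₚ-assoc y x z))

  *ₚ-identityʳ : ∀ {e} (q : HPoly e) → (q *ₚ one) ≋ q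
  *ₚ-identityʳ {e} q = ≋-byCoeff (NP.+-identityʳ e)
    (≐-trans (coeff-* q one) (≐-trans (conv-congʳ (coeff q) coeff-one) (conv-identityʳ (coeff q))))

  *ₚ-identityˡ : ∀ {e} (q : HPoly e) → (one *ₚ q) ≋ q
  *ₚ-identityˡ q = ≋-byCoeff P.refl
    (≐-trans (coeff-* one q) (≐-trans (conv-congˡ (coeff q) coeff-one) (conv-identityˡ (coeff q))))

  ·ₚ-cong : ∀ {d e} x {a : HPoly d} {b : HPoly e} → a ≋ b → (x ·ₚ a) ≋ (x ·ₚ b)
  ·ₚ-cong x {a} {b} a≋b with ≋-degree a≋b
  ... | inj₁ d≡e = ≋-byCoeff d≡e (≐-trans (coeff-· x a) (≐-trans (λ i → *-congˡ (≋⇒≐ a≋b i)) (≐-sym (coeff-· x b))))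
  ... | inj₂ a≐𝟘 = ≋-𝟘 (λ i → trans (coeff-· x a i) (trans (*-congˡ (a≐𝟘 i)) (zeroʳ x)))
                      (λ i → trans (coeff-· x b i) (trans (*-congˡ (trans (sym (≋⇒≐ a≋b i)) (a≐𝟘 i))) (zeroʳ x)))

  *ₚ-·ₚ : ∀ {d e} x (a : HPoly d) (b : HPoly e) → (a *ₚ (x ·ₚ b)) ≋ (x ·ₚ (a *ₚ b))
  *ₚ-·ₚ x a b = ≋-byCoeff P.refl λ i → begin
    coeff (a *ₚ (x ·ₚ b)) i                 ≈⟨ coeff-* a (x ·ₚ b) i ⟩
    conv (coeff a) (coeff (x ·ₚ b)) i       ≈⟨ conv-congʳ (coeff a) (coeff-· x b) i ⟩
    conv (coeff a) (scale x (coeff b)) i    ≈⟨ conv-scaleʳ x (coeff a) (coeff b) i ⟩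
    x * conv (coeff a) (coeff b) i          ≈⟨ *-congˡ (coeff-* a b i) ⟨
    x * coeff (a *ₚ b) i                    ≈⟨ coeff-· x (a *ₚ b) i ⟨
    coeff (x ·ₚ (a *ₚ b)) i                 ∎

  ·ₚ-inverse : ∀ {d} (f : HPoly d) x x≉0 → (inv x x≉0 ·ₚ (x ·ₚ f)) ≋ f
  ·ₚ-inverse f x x≉0 = ≋-byCoeff P.refl λ i →
    trans (coeff-· _ (x ·ₚ f) i) (trans (*-congˡ (coeff-· x f i)) (inv-cancelˡ x x≉0 (coeff f i)))

  divides : ∀ {e d m} {q : HPoly e} {f : HPoly d} (u : HPoly m) → (q *ₚ u) ≋ f → q ∣ f
  divides {m = m} u (mk≋ qu≈f) = mk∣ (m , u , qu≈f)

  witness : ∀ {e d} {q : HPoly e} {f : HPoly d} → q ∣ f → Σ ℕ λ m → Σ (HPoly m) λ u → (q *ₚ u) ≋ f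
  witness {q = q} {f} (mk∣ (m , u , qu≈f)) = m , u , mk≋ {f = q *ₚ u} {g = f} qu≈f

  ∣-respʳ : ∀ {e d k} {q : HPoly e} {f : HPoly d} {g : HPoly k} → q ∣ f → f ≋ g → q ∣ g
  ∣-respʳ q∣f f≋g = let (_ , u , qu≋f) = witness q∣f in divides u (≋-trans qu≋f f≋g)

  ∣-respˡ : ∀ {e e' d} {q : HPoly e} {q' : HPoly e'} {f : HPoly d} → q ≋ q' → q ∣ f → q' ∣ f
  ∣-respˡ q≋q' q∣f = let (_ , u , qu≋f) = witness q∣f in divides u (≋-trans (*ₚ-cong (≋-sym q≋q') (≋-refl {f = u})) qu≋f)

  ∣-refl : ∀ {e} (q : HPoly e) → q ∣ q
  ∣-refl q = divides one (*ₚ-identityʳ q)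

  one∣ : ∀ {e} (q : HPoly e) → one ∣ q
  one∣ q = divides q (*ₚ-identityˡ q)

  ∣-trans : ∀ {e d k} {q : HPoly e} {a : HPoly d} {b : HPoly k} → q ∣ a → a ∣ b → q ∣ b
  ∣-trans {q = q} q∣a a∣b =
    let (_ , u , qu≋a) = witness q∣a
        (_ , v , av≋b) = witness a∣b
    in divides (u *ₚ v) (≋-trans (≋-sym (*ₚ-assoc q u v)) (≋-trans (*ₚ-cong qu≋a (≋-refl {f = v})) av≋b))

  ∣m⇒∣m*n : ∀ {e d k} {q : HPoly e} {a : HPoly d} (b : HPoly k) → q ∣ a → q ∣ (a *ₚ b)
  ∣m⇒∣m*n {q = q} b q∣a =
    let (_ , u , qu≋a) = witness q∣a
    in divides (u *ₚ b) (≋-trans (≋-sym (*ₚ-assoc q u b)) (*ₚ-cong qu≋a (≋-refl {f = b})))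

  ∣n⇒∣m*n : ∀ {e d k} {q : HPoly e} (a : HPoly d) {b : HPoly k} → q ∣ b → q ∣ (a *ₚ b)
  ∣n⇒∣m*n a {b} q∣b = ∣-respʳ (∣m⇒∣m*n a q∣b) (*ₚ-comm b a)

  *-pres-∣ : ∀ {e e' d k} {q : HPoly e} {r : HPoly e'} {a : HPoly d} {b : HPoly k} → q ∣ a → r ∣ b → (q *ₚ r) ∣ (a *ₚ b)
  *-pres-∣ {q = q} {r} q∣a r∣b =
    let (_ , u , qu≋a) = witness q∣a
        (_ , v , rv≋b) = witness r∣b
    in divides (u *ₚ v) (≋-trans (*ₚ-assoc q r (u *ₚ v)) (≋-trans (*ₚ-cong (≋-refl {f = q}) (*ₚ-swap r u v))
                        (≋-trans (≋-sym (*ₚ-assoc q u (r *ₚ v))) (*ₚ-cong qu≋a rv≋b))))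

  *-monoˡ-∣ : ∀ {e d k} (r : HPoly e) {a : HPoly d} {b : HPoly k} → a ∣ b → (r *ₚ a) ∣ (r *ₚ b)
  *-monoˡ-∣ r a∣b = *-pres-∣ (∣-refl r) a∣b

  ∣-·ₚ : ∀ {e d} {q : HPoly e} {f : HPoly d} x → q ∣ f → q ∣ (x ·ₚ f)
  ∣-·ₚ {q = q} x q∣f = let (_ , u , qu≋f) = witness q∣f in divides (x ·ₚ u) (≋-trans (*ₚ-·ₚ x q u) (·ₚ-cong x qu≋f))

  ∣-unscale : ∀ {e d} {q : HPoly e} {f : HPoly d} x → ¬ x ≈ 0# → q ∣ (x ·ₚ f) → q ∣ f
  ∣-unscale {f = f} x x≉0 q∣xf = ∣-respʳ (∣-·ₚ (inv x x≉0) q∣xf) (·ₚ-inverse f x x≉0)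

  ∣-fromSeq : ∀ {e d m} (q : HPoly e) (f : HPoly d) (u : Seq) → Deg≤ u m → e N.+ m ≡ d → conv (coeff q) u ≐ coeff f → q ∣ f
  ∣-fromSeq {m = m} q f u u≤m e+m≡d qu≐f = divides (fromSeq m u) (≋-byCoeff e+m≡d
    (≐-trans (coeff-* q (fromSeq m u)) (≐-trans (conv-congʳ (coeff q) (coeff-fromSeq u≤m)) qu≐f)))

  ∣-𝟘 : ∀ {e d} (q : HPoly e) (f : HPoly d) → coeff f ≐ 𝟘 → q ∣ f
  ∣-𝟘 q f f≐𝟘 = divides (fromSeq 0 𝟘) (≋-𝟘 (*ₚ-zeroʳ q (fromSeq 0 𝟘) (coeff-fromSeq Deg≤-𝟘)) f≐𝟘)

  ∣-elim : ∀ {e d} {q : HPoly e} {f : HPoly d} → q ∣ f →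
    Σ ℕ λ m → Σ Seq λ u → Deg≤ u m × conv (coeff q) u ≐ coeff f × ((e N.+ m ≡ d) ⊎ (coeff f ≐ 𝟘))
  ∣-elim {q = q} {f} (mk∣ (m , u , qu≈f)) = m , coeff u , coeff-Deg≤ u , qu≐f , degree
    where
    qu≐f = ≐-trans (≐-sym (coeff-* q u)) (≈ₚ⇒≐ (q *ₚ u) f qu≈f)
    degree : _
    degree with ≈ₚ-degree (q *ₚ u) f qu≈f
    ... | inj₁ e+m≡d = inj₁ e+m≡d
    ... | inj₂ qu≐𝟘  = inj₂ (≐-trans (≐-sym (≈ₚ⇒≐ (q *ₚ u) f qu≈f)) qu≐𝟘)

  ∣-deg<⇒𝟘 : ∀ {e d} {q : HPoly e} {f : HPoly d} → q ∣ f → d N.< e → coeff f ≐ 𝟘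
  ∣-deg<⇒𝟘 {e} q∣f d<e with ∣-elim q∣f
  ... | m , _ , _ , _ , inj₁ e+m≡d = ⊥-elim (NP.<⇒≱ d<e (P.subst (e N.≤_) e+m≡d (NP.m≤m+n e m)))
  ... | _ , _ , _ , _ , inj₂ f≐𝟘   = f≐𝟘

  ∣⇒deg≤ : ∀ {e d} {q : HPoly e} {f : HPoly d} → q ∣ f → ¬ (coeff f ≐ 𝟘) → e N.≤ d
  ∣⇒deg≤ {e} {d} q∣f f≉𝟘 with e N.≤? d
  ... | yes e≤d = e≤d
  ... | no  e≰d = ⊥-elim (f≉𝟘 (∣-deg<⇒𝟘 q∣f (NP.≰⇒> e≰d)))

  ∣-quotient : ∀ {e d} {q : HPoly e} {f : HPoly d} → q ∣ f → e N.≤ d →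
    Σ Seq λ u → Deg≤ u (d N.∸ e) × conv (coeff q) u ≐ coeff f
  ∣-quotient {e} q∣f e≤d with ∣-elim q∣f
  ... | m , u , u≤m , qu≐f , inj₁ e+m≡d = u , P.subst (Deg≤ u) (P.trans (P.sym (NP.m+n∸m≡n e m)) (P.cong (N._∸ e) e+m≡d)) u≤m , qu≐f
  ... | _ , _ , _   , _    , inj₂ f≐𝟘   = 𝟘 , Deg≤-𝟘 , ≐-trans (conv-zeroʳ _) (≐-sym f≐𝟘)

  quotient : ∀ {e d} {q : HPoly e} {f : HPoly d} → q ∣ f → e N.≤ d → Σ (HPoly (d N.∸ e)) λ u → f ≋ (q *ₚ u)
  quotient {e} {d} {q} {f} q∣f e≤d with ∣-quotient q∣f e≤d
  ... | u , u≤d-e , qu≐f = fromSeq (d N.∸ e) u , ≋-byCoeff (P.sym (NP.m+[n∸m]≡n e≤d))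
    (≐-sym (≐-trans (coeff-* q (fromSeq (d N.∸ e) u)) (≐-trans (conv-congʳ (coeff q) (coeff-fromSeq u≤d-e)) qu≐f)))

  ∣-sub : ∀ {e d} {q : HPoly e} {a b : HPoly d} → q ∣ a → q ∣ b → q ∣ (a -ₚ b)
  ∣-sub {e} {d} {q} {a} {b} q∣a q∣b with e N.≤? d
  ... | no e≰d = ∣-𝟘 q (a -ₚ b) λ i → trans (coeff-sub a b i)
                   (trans (+-cong (∣-deg<⇒𝟘 q∣a (NP.≰⇒> e≰d) i) (-‿cong (∣-deg<⇒𝟘 q∣b (NP.≰⇒> e≰d) i))) (-‿inverseʳ 0#))
  ... | yes e≤d with ∣-quotient q∣a e≤d | ∣-quotient q∣b e≤d
  ...   | u , u≤ , qu≐a | v , v≤ , qv≐b = ∣-fromSeq q (a -ₚ b) (u ⊖ v) (Deg≤-⊖ u≤ v≤) (NP.m+[n∸m]≡n e≤d)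
          (≐-trans (conv-distribˡ-⊖ u v (coeff q)) (≐-trans (λ i → +-cong (qu≐a i) (-‿cong (qv≐b i))) (≐-sym (coeff-sub a b))))

  nonzeroConstant∣ : ∀ {k d} (q : HPoly k) (f : HPoly d) → k ≡ 0 → ¬ (coeff q ≐ 𝟘) → q ∣ f
  nonzeroConstant∣ q f P.refl q≉𝟘 = ∣-fromSeq q f (scale q0⁻¹ (coeff f)) (Deg≤-scale q0⁻¹ (coeff-Deg≤ f)) P.refl λ i → begin
    conv (coeff q) (scale q0⁻¹ (coeff f)) i              ≈⟨ conv-congˡ (scale q0⁻¹ (coeff f)) (Deg≤0⇒constant (coeff-Deg≤ q)) i ⟩
    conv (constant (coeff q 0)) (scale q0⁻¹ (coeff f)) i ≈⟨ conv-constantˡ _ (scale q0⁻¹ (coeff f)) i ⟩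
    coeff q 0 * (q0⁻¹ * coeff f i)                       ≈⟨ *-assoc _ _ _ ⟨
    (coeff q 0 * q0⁻¹) * coeff f i                       ≈⟨ *-congʳ (inv-inverseʳ _ q0≉0) ⟩
    1# * coeff f i                                       ≈⟨ *-identityˡ _ ⟩
    coeff f i                                            ∎
    where
    q0≉0 = λ q0≈0 → q≉𝟘 (Deg≤0⇒≐𝟘 (coeff-Deg≤ q) q0≈0)
    q0⁻¹ = inv (coeff q 0) q0≉0

  *-cancelˡ-∣ : ∀ {e d k} (r : HPoly e) {a : HPoly d} {b : HPoly k} → ¬ (coeff r ≐ 𝟘) → (r *ₚ a) ∣ (r *ₚ b) → a ∣ b
  *-cancelˡ-∣ {e} {d} {k} r {a} {b} r≉𝟘 ra∣rb with degree? e (coeff r) (coeff-Deg≤ r) | degree? k (coeff b) (coeff-Deg≤ b)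
  ... | inj₁ r≐𝟘  | _          = ⊥-elim (r≉𝟘 r≐𝟘)
  ... | _         | inj₁ b≐𝟘   = ∣-𝟘 a b b≐𝟘
  ... | inj₂ deg-r | inj₂ deg-b = cancel (∣-quotient ra∣rb e+d≤e+k)
    where
    e+d≤e+k : e N.+ d N.≤ e N.+ k
    e+d≤e+k = ∣⇒deg≤ ra∣rb (λ rb≐𝟘 → HasDegree⇒≉𝟘 (conv-HasDegree deg-r deg-b) (≐-trans (≐-sym (coeff-* r b)) rb≐𝟘))
    d≤k = NP.+-cancelˡ-≤ e d k e+d≤e+k
    cancel : Σ Seq (λ u → Deg≤ u (e N.+ k N.∸ (e N.+ d)) × conv (coeff (r *ₚ a)) u ≐ coeff (r *ₚ b)) → a ∣ b
    cancel (u , u≤ , rau≐rb) = ∣-fromSeq a b u u≤k-d (NP.m+[n∸m]≡n d≤k)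
      (conv-cancelˡ k deg-r au≤k (coeff-Deg≤ b) λ i → begin
        conv (coeff r) (conv (coeff a) u) i ≈⟨ conv-assoc (coeff r) (coeff a) u i ⟨
        conv (conv (coeff r) (coeff a)) u i ≈⟨ conv-congˡ u (coeff-* r a) i ⟨
        conv (coeff (r *ₚ a)) u i           ≈⟨ rau≐rb i ⟩
        coeff (r *ₚ b) i                    ≈⟨ coeff-* r b i ⟩
        conv (coeff r) (coeff b) i          ∎)
      where
      u≤k-d = P.subst (Deg≤ u) (NP.[m+n]∸[m+o]≡n∸o e k d) u≤
      au≤k = P.subst (Deg≤ _) (NP.m+[n∸m]≡n d≤k) (conv-Deg≤ d (k N.∸ d) (coeff-Deg≤ a) u≤k-d)

module Factorization {c ℓ : Level} (𝕜 : FiniteField c ℓ) where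
  open Divisibility 𝕜 public
  open import Relation.Binary.Reasoning.Setoid setoid

  Y≉𝟘 : ¬ (coeff Y ≐ 𝟘)
  Y≉𝟘 Y≐𝟘 = 1≉0 (Y≐𝟘 0)

  top≈0⇒Y∣ : ∀ {d} (w : HPoly d) → coeff w d ≈ 0# → Y ∣ w
  top≈0⇒Y∣ {zero} w w0≈0 = ∣-𝟘 Y w (Deg≤0⇒≐𝟘 (coeff-Deg≤ w) w0≈0)
  top≈0⇒Y∣ {suc n} w top≈0 = ∣-fromSeq Y w (coeff w) (Deg≤-pred (coeff-Deg≤ w) top≈0) P.refl
    (≐-trans (conv-congˡ (coeff w) coeff-Y) (conv-identityˡ (coeff w)))

  Y∣⇒top≈0 : ∀ {d} (w : HPoly d) → Y ∣ w → coeff w d ≈ 0#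
  Y∣⇒top≈0 {zero}  w Y∣w = ∣-deg<⇒𝟘 Y∣w (s≤s z≤n) 0
  Y∣⇒top≈0 {suc n} w Y∣w with ∣-quotient Y∣w (s≤s z≤n)
  ... | u , u≤n , Yu≐w = begin
    coeff w (suc n)                   ≈⟨ Yu≐w (suc n) ⟨
    conv (coeff Y) u (suc n)          ≈⟨ conv-congˡ u coeff-Y (suc n) ⟩
    conv (constant 1#) u (suc n)      ≈⟨ conv-identityˡ u (suc n) ⟩
    u (suc n)                         ≈⟨ u≤n (suc n) (NP.n<1+n n) ⟩
    0#                                ∎

  ∣-sameDegree⇒multiple : ∀ {e} {q r : HPoly e} → q ∣ r → Σ Carrier λ k → coeff r ≐ scale k (coeff q)
  ∣-sameDegree⇒multiple {e} {q} {r} q∣r with ∣-quotient q∣r NP.≤-refl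
  ... | u , u≤0 , qu≐r = u 0 , λ i → begin
    coeff r i                       ≈⟨ qu≐r i ⟨
    conv (coeff q) u i              ≈⟨ conv-congʳ (coeff q) (Deg≤0⇒constant (P.subst (Deg≤ u) (NP.n∸n≡0 e) u≤0)) i ⟩
    conv (coeff q) (constant (u 0)) i ≈⟨ conv-constantʳ (u 0) (coeff q) i ⟩
    u 0 * coeff q i                 ∎

  ∣⇒∣-sameDegree : ∀ {e} (q r : HPoly e) → q ∣ r → ¬ (coeff r ≐ 𝟘) → r ∣ q
  ∣⇒∣-sameDegree {e} q r q∣r r≉𝟘 with ∣-sameDegree⇒multiple q∣r
  ... | k , r≐kq = ∣-fromSeq r q (constant k⁻¹) (λ { (suc i) _ → refl }) (NP.+-identityʳ e) λ i → begin
    conv (coeff r) (constant k⁻¹) i ≈⟨ conv-constantʳ k⁻¹ (coeff r) i ⟩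
    k⁻¹ * coeff r i                 ≈⟨ *-congˡ (r≐kq i) ⟩
    k⁻¹ * (k * coeff q i)           ≈⟨ inv-cancelˡ k k≉0 (coeff q i) ⟩
    coeff q i                       ∎
    where
    k≉0 : ¬ k ≈ 0#
    k≉0 k≈0 = r≉𝟘 (λ i → trans (r≐kq i) (trans (*-congʳ k≈0) (zeroˡ _)))
    k⁻¹ = inv k k≉0

  ∣Y⇒Y∣ : ∀ {e} (π : HPoly e) → ¬ e ≡ 0 → π ∣ Y → Y ∣ π
  ∣Y⇒Y∣ {zero}        π e≢0 _   = ⊥-elim (e≢0 P.refl)
  ∣Y⇒Y∣ {suc zero}    π _   π∣Y = ∣⇒∣-sameDegree π Y π∣Y Y≉𝟘
  ∣Y⇒Y∣ {suc (suc e)} π _   π∣Y = ⊥-elim (Y≉𝟘 (∣-deg<⇒𝟘 π∣Y (s≤s (s≤s z≤n))))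

  ∣-nonzero : ∀ {e d} {q : HPoly e} {a : HPoly d} → q ∣ a → ¬ (coeff a ≐ 𝟘) → ¬ (coeff q ≐ 𝟘)
  ∣-nonzero {q = q} q∣a a≉𝟘 q≐𝟘 =
    let (_ , u , qu≋a) = witness q∣a in a≉𝟘 (≐-trans (≐-sym (≋⇒≐ qu≋a)) (*ₚ-zeroˡ q u q≐𝟘))

  irreducible⇒≉𝟘 : ∀ {e} (π : HPoly e) → Irreducible π → ¬ (coeff π ≐ 𝟘)
  irreducible⇒≉𝟘 {e} π (_ , π-irr) π≐𝟘 with π-irr (suc e) (fromSeq (suc e) 𝟘) (un∣ (∣-𝟘 (fromSeq (suc e) 𝟘) π π≐𝟘))
  ... | inj₂ 1+e≡e = NP.<-irrefl (P.sym 1+e≡e) (NP.n<1+n e)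

  monic⇒≉𝟘 : ∀ {e} (π : HPoly e) → Monic π → ¬ (coeff π ≐ 𝟘)
  monic⇒≉𝟘 π (i , πi≈1 , _) π≐𝟘 = 1≉0 (trans (sym πi≈1) (π≐𝟘 i))

  ∷-≐ : ∀ {n x y} {u v : Vec Carrier n} → x ≈ y → coeffV u ≐ coeffV v → coeffV (x ∷ u) ≐ coeffV (y ∷ v)
  ∷-≐ x≈y u≐v zero    = x≈y
  ∷-≐ x≈y u≐v (suc i) = u≐v i

  -- The only use of the finiteness of the field.
  ∃Vec? : ∀ {p} n (Q : Vec Carrier n → Set p) → (∀ u v → coeffV u ≐ coeffV v → Q u → Q v) → (∀ u → Dec (Q u)) →
          Dec (Σ (Vec Carrier n) Q)
  ∃Vec? zero    Q Q-resp Q? = map′ ([] ,_) (λ { ([] , Q[]) → Q[] }) (Q? [])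
  ∃Vec? (suc n) Q Q-resp Q? = map′ (λ (i , v , Q[iv]) → enum i ∷ v , Q[iv]) enumerate
    (FP.any? λ i → ∃Vec? n (λ v → Q (enum i ∷ v)) (λ u v u≐v → Q-resp _ _ (∷-≐ refl u≐v)) (λ v → Q? (enum i ∷ v)))
    where
    enumerate : Σ (Vec Carrier (suc n)) Q → Σ (Fin card) λ i → Σ (Vec Carrier n) λ v → Q (enum i ∷ v)
    enumerate (x ∷ v , Q[xv]) = let (i , enum-i≈x) = enum-surj x in i , v , Q-resp _ _ (∷-≐ (sym enum-i≈x) (λ _ → refl)) Q[xv]

  ≐? : ∀ n a b → Deg≤ a n → Deg≤ b n → Dec (a ≐ b)
  ≐? n a b a≤n b≤n with NP.allUpTo? (λ i → a i ≟ₖ b i) (suc n)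
  ... | no  ¬a≐b = no λ a≐b → ¬a≐b (λ {i} _ → a≐b i)
  ... | yes a≐b≤n = yes a≐b
    where
    a≐b : a ≐ b
    a≐b i with i N.≤? n
    ... | yes i≤n = a≐b≤n (s≤s i≤n)
    ... | no  i≰n = trans (a≤n i (NP.≰⇒> i≰n)) (sym (b≤n i (NP.≰⇒> i≰n)))

  ∣? : ∀ {e d} (q : HPoly e) (f : HPoly d) → Dec (q ∣ f)
  ∣? {e} {d} q f with degree? d (coeff f) (coeff-Deg≤ f)
  ... | inj₁ f≐𝟘 = yes (∣-𝟘 q f f≐𝟘)
  ... | inj₂ deg-f with e N.≤? d
  ...   | no  e≰d = no λ q∣f → HasDegree⇒≉𝟘 deg-f (∣-deg<⇒𝟘 q∣f (NP.≰⇒> e≰d))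
  ...   | yes e≤d with ∃Vec? (suc (d N.∸ e)) (λ u → conv (coeff q) (coeffV u) ≐ coeff f)
                      (λ u v u≐v qu≐f → ≐-trans (≐-sym (conv-congʳ (coeff q) u≐v)) qu≐f)
                      (λ u → ≐? d _ _ (P.subst (Deg≤ _) (NP.m+[n∸m]≡n e≤d) (conv-Deg≤ e _ (coeff-Deg≤ q) (coeff-Deg≤ {d N.∸ e} u)))
                                  (coeff-Deg≤ f))
  ...     | yes (u , qu≐f) = yes (∣-fromSeq q f (coeffV u) (coeff-Deg≤ {d N.∸ e} u) (NP.m+[n∸m]≡n e≤d) qu≐f)
  ...     | no  none       = no λ q∣f → let (u , u≤ , qu≐f) = ∣-quotient q∣f e≤d in
                               none (fromSeq (d N.∸ e) u , ≐-trans (conv-congʳ (coeff q) (coeff-fromSeq u≤)) qu≐f)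

  IrreducibleFactor : ∀ {d} → HPoly d → Set (c ⊔ ℓ)
  IrreducibleFactor a = Σ ℕ λ e → Σ (HPoly e) λ π → Irreducible π × π ∣ a

  ProperDivisor : ∀ {d} → HPoly d → Set (c ⊔ ℓ)
  ProperDivisor {d} a = Σ ℕ λ m → m N.< d × 0 N.< m × Σ (HPoly m) λ q → q ∣ a

  properDivisor? : ∀ {d} (a : HPoly d) → Dec (ProperDivisor a)
  properDivisor? {d} a = NP.anyUpTo? (λ m → 0 N.<? m ×-dec ∃divisor? m) d
    where
    ∃divisor? : ∀ m → Dec (Σ (HPoly m) λ q → q ∣ a)
    ∃divisor? m = ∃Vec? (suc m) (_∣ a) (λ u v u≐v → ∣-respˡ (≋-byCoeff P.refl u≐v)) (λ q → ∣? q a)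

  ¬ProperDivisor⇒irreducible : ∀ {d} (a : HPoly d) → ¬ (coeff a ≐ 𝟘) → ¬ d ≡ 0 → ¬ ProperDivisor a → Irreducible a
  ¬ProperDivisor⇒irreducible {d} a a≉𝟘 d≢0 none = d≢0 , degree-0-or-d
    where
    degree-0-or-d : ∀ m (q : HPoly m) → q ∣ₚ a → (m ≡ 0) ⊎ (m ≡ d)
    degree-0-or-d m q q∣a with m N.≟ 0 | m N.≟ d
    ... | yes m≡0 | _       = inj₁ m≡0
    ... | no  _   | yes m≡d = inj₂ m≡d
    ... | no  m≢0 | no  m≢d = ⊥-elim (none (m , NP.≤∧≢⇒< (∣⇒deg≤ q∣′a a≉𝟘) m≢d , NP.n≢0⇒n>0 m≢0 , q , q∣′a))
      where q∣′a = mk∣ {q = q} {f = a} q∣a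

  irreducibleFactor : ∀ {d} (a : HPoly d) → ¬ (coeff a ≐ 𝟘) → ¬ d ≡ 0 → IrreducibleFactor a
  irreducibleFactor {d} = <-rec (λ d → (a : HPoly d) → ¬ (coeff a ≐ 𝟘) → ¬ d ≡ 0 → IrreducibleFactor a) step d
    where
    step : ∀ d → (∀ {m} → m N.< d → (q : HPoly m) → ¬ (coeff q ≐ 𝟘) → ¬ m ≡ 0 → IrreducibleFactor q) →
           (a : HPoly d) → ¬ (coeff a ≐ 𝟘) → ¬ d ≡ 0 → IrreducibleFactor a
    step d smaller a a≉𝟘 d≢0 with properDivisor? a
    ... | no  none = d , a , ¬ProperDivisor⇒irreducible a a≉𝟘 d≢0 none , ∣-refl a
    ... | yes (m , m<d , 0<m , q , q∣a) with smaller m<d q (∣-nonzero q∣a a≉𝟘) (λ m≡0 → NP.<⇒≢ 0<m (P.sym m≡0))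
    ...   | e , π , π-irr , π∣q = e , π , π-irr , ∣-trans π∣q q∣a

  monicMultiple : ∀ {d} (f : HPoly d) → ¬ (coeff f ≐ 𝟘) → Σ Carrier λ x → ¬ x ≈ 0# × Monic (x ·ₚ f)
  monicMultiple {d} f f≉𝟘 with degree? d (coeff f) (coeff-Deg≤ f)
  ... | inj₁ f≐𝟘 = ⊥-elim (f≉𝟘 f≐𝟘)
  ... | inj₂ (k , fk≉0 , f≤k) =
    fk⁻¹ , inv-nonzero _ fk≉0 , k , trans (coeff-· fk⁻¹ f k) (inv-inverseˡ _ fk≉0) ,
    λ j k<j → trans (coeff-· fk⁻¹ f j) (trans (*-congˡ (f≤k j k<j)) (zeroʳ _))
    where fk⁻¹ = inv (coeff f k) fk≉0

  monicAssociate : ∀ {e} (π : HPoly e) → Irreducible π →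
                   Σ (HPoly e) λ π′ → Monic π′ × Irreducible π′ × π′ ∣ π × π ∣ π′
  monicAssociate {e} π (e≢0 , π-irr) = associate (monicMultiple π (irreducible⇒≉𝟘 π (e≢0 , π-irr)))
    where
    associate : Σ Carrier (λ x → ¬ x ≈ 0# × Monic (x ·ₚ π)) →
                Σ (HPoly e) λ π′ → Monic π′ × Irreducible π′ × π′ ∣ π × π ∣ π′
    associate (x , x≉0 , xπ-monic) = x ·ₚ π , xπ-monic , (e≢0 , xπ-irr) , xπ∣π , ∣-·ₚ x (∣-refl π)
      where
      xπ∣π : (x ·ₚ π) ∣ π
      xπ∣π = ∣-respʳ (∣-·ₚ (inv x x≉0) (∣-refl (x ·ₚ π))) (·ₚ-inverse π x x≉0)
      xπ-irr : ∀ m (q : HPoly m) → q ∣ₚ (x ·ₚ π) → (m ≡ 0) ⊎ (m ≡ e)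
      xπ-irr m q q∣xπ = π-irr m q (un∣ (∣-trans (mk∣ {q = q} {f = x ·ₚ π} q∣xπ) xπ∣π))

  MonicIrreducibleFactor : ∀ {d} → HPoly d → Set (c ⊔ ℓ)
  MonicIrreducibleFactor a = Σ ℕ λ e → Σ (HPoly e) λ π → Monic π × Irreducible π × π ∣ a

  monicIrreducibleFactor : ∀ {d} (a : HPoly d) → ¬ (coeff a ≐ 𝟘) → ¬ d ≡ 0 → MonicIrreducibleFactor a
  monicIrreducibleFactor a a≉𝟘 d≢0 =
    let (e , π₀ , π₀-irr , π₀∣a) = irreducibleFactor a a≉𝟘 d≢0
        (π , π-monic , π-irr , π∣π₀ , _) = monicAssociate π₀ π₀-irr
    in e , π , π-monic , π-irr , ∣-trans π∣π₀ π₀∣a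

  pow-mono-∣ : ∀ {e} (π : HPoly e) {m n} → m N.≤ n → pow π m ∣ pow π n
  pow-mono-∣ π {zero}  {zero}  _         = ∣-refl one
  pow-mono-∣ π {zero}  {suc n} _         = ∣n⇒∣m*n π (pow-mono-∣ π {zero} {n} z≤n)
  pow-mono-∣ π {suc m} {suc n} (s≤s m≤n) = *-monoˡ-∣ π (pow-mono-∣ π m≤n)

  pow∣⇒exponent≤ : ∀ {e d} (π : HPoly e) → ¬ e ≡ 0 → (a : HPoly d) → ¬ (coeff a ≐ 𝟘) → ∀ k → pow π k ∣ a → k N.≤ d
  pow∣⇒exponent≤ {e} π e≢0 a a≉𝟘 k πᵏ∣a = NP.≤-trans (NP.m≤m*n k e {{N.≢-nonZero e≢0}}) (∣⇒deg≤ πᵏ∣a a≉𝟘)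

  ord-exists : ∀ {d} (P : ClosedPoint) (a : HPoly d) → ¬ (coeff a ≐ 𝟘) → Σ ℕ (Ord P a)
  ord-exists {d} P a a≉𝟘 = climb (suc d) 0 (one∣ a) (s≤s NP.≤-refl)
    where
    π = ClosedPoint.poly P
    climb : ∀ fuel k → pow π k ∣ a → d N.< k N.+ fuel → Σ ℕ (Ord P a)
    climb zero k πᵏ∣a d<k = ⊥-elim (NP.<⇒≱ (P.subst (d N.<_) (NP.+-identityʳ k) d<k)
                                          (pow∣⇒exponent≤ π (proj₁ (ClosedPoint.irred P)) a a≉𝟘 k πᵏ∣a))
    climb (suc fuel) k πᵏ∣a d<k+1+fuel with ∣? (pow π (suc k)) a
    ... | yes πᵏ⁺¹∣a = climb fuel (suc k) πᵏ⁺¹∣a (P.subst (d N.<_) (NP.+-suc k fuel) d<k+1+fuel)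
    ... | no  πᵏ⁺¹∤a = k , un∣ πᵏ∣a , λ πᵏ⁺¹∣ₚa → πᵏ⁺¹∤a (mk∣ πᵏ⁺¹∣ₚa)

  ≡Div⇒pow∣ : ∀ {d k} (p : HPoly d) (f : HPoly k) → ¬ (coeff p ≐ 𝟘) → f ≡Div p →
              ∀ (P : ClosedPoint) n → pow (ClosedPoint.poly P) n ∣ p → pow (ClosedPoint.poly P) n ∣ f
  ≡Div⇒pow∣ p f p≉𝟘 f≡p P n πⁿ∣p with ord-exists P p p≉𝟘
  ... | N , πᴺ∣p , πᴺ⁺¹∤p with n N.≤? N
  ...   | no  n≰N = ⊥-elim (πᴺ⁺¹∤p (un∣ (∣-trans (pow-mono-∣ (ClosedPoint.poly P) (NP.≰⇒> n≰N)) πⁿ∣p)))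
  ...   | yes n≤N = ∣-trans (pow-mono-∣ (ClosedPoint.poly P) n≤N) (mk∣ (proj₁ (Equivalence.from (f≡p P N) (πᴺ∣p , πᴺ⁺¹∤p))))

module EuclidsLemma {c ℓ : Level} (𝕜 : FiniteField c ℓ) where
  open Factorization 𝕜 public
  open import Relation.Binary.Reasoning.Setoid setoid
  open import Algebra.Properties.Group +-group using (//-rightDividesˡ; //-rightDividesʳ)

  nonzero⇒≤bound : ∀ {a n k} → Deg≤ a n → ¬ a k ≈ 0# → k N.≤ n
  nonzero⇒≤bound {n = n} {k} a≤n ak≉0 with k N.≤? n
  ... | yes k≤n = k≤n
  ... | no  k≰n = ⊥-elim (ak≉0 (a≤n k (NP.≰⇒> k≰n)))

  monomial : ℕ → Seq
  monomial j i with i N.≟ j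
  ... | yes _ = 1#
  ... | no  _ = 0#

  monomial-Deg≤ : ∀ j → Deg≤ (monomial j) j
  monomial-Deg≤ j i j<i with i N.≟ j
  ... | yes P.refl = ⊥-elim (NP.<-irrefl P.refl j<i)
  ... | no  _      = refl

  conv-monomialʳ : ∀ j g i → j N.≤ i → conv g (monomial j) i ≈ g (i N.∸ j)
  conv-monomialʳ j g i j≤i = trans (conv-comm g _ i) (trans (sumUpTo-single i j j≤i off-j) (trans (*-congʳ monomial-j) (*-identityˡ _)))
    where
    off-j : ∀ k → k N.≤ i → ¬ k ≡ j → monomial j k * g (i N.∸ k) ≈ 0#
    off-j k _ k≢j with k N.≟ j
    ... | yes k≡j = ⊥-elim (k≢j k≡j)
    ... | no  _   = zeroˡ _
    monomial-j : monomial j j ≈ 1#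
    monomial-j with j N.≟ j
    ... | yes _   = refl
    ... | no  j≢j = ⊥-elim (j≢j P.refl)

  module DivisionWithRemainder (g : Seq) (k : ℕ) (g≤ : Deg≤ g (suc k)) (gtop≉0 : ¬ g (suc k) ≈ 0#) where

    DivMod : Seq → ℕ → Set (c ⊔ ℓ)
    DivMod a n = Σ Seq λ q → Σ Seq λ r → Deg≤ q n × Deg≤ r k × a ≐ conv g q ⊕ r

    gtop⁻¹ = inv (g (suc k)) gtop≉0

    cancelTop : Seq → ℕ → Seq
    cancelTop a n = scale (a n * gtop⁻¹) (monomial (n N.∸ suc k))

    cancelTop-Deg≤ : ∀ a n → Deg≤ (cancelTop a n) n
    cancelTop-Deg≤ a n = Deg≤-mono (NP.m∸n≤m n (suc k)) (Deg≤-scale _ (monomial-Deg≤ (n N.∸ suc k)))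

    conv-cancelTop-top : ∀ a n → suc k N.≤ n → conv g (cancelTop a n) n ≈ a n
    conv-cancelTop-top a n k<n = begin
      conv g (cancelTop a n) n               ≈⟨ conv-scaleʳ _ g (monomial (n N.∸ suc k)) n ⟩
      (a n * gtop⁻¹) * conv g (monomial (n N.∸ suc k)) n ≈⟨ *-congˡ (conv-monomialʳ _ g n (NP.m∸n≤m n (suc k))) ⟩
      (a n * gtop⁻¹) * g (n N.∸ (n N.∸ suc k)) ≈⟨ *-congˡ (reflexive (P.cong g (NP.m∸[m∸n]≡n k<n))) ⟩
      (a n * gtop⁻¹) * g (suc k)             ≈⟨ *-assoc _ _ _ ⟩
      a n * (gtop⁻¹ * g (suc k))             ≈⟨ *-congˡ (inv-inverseˡ _ gtop≉0) ⟩
      a n * 1#                               ≈⟨ *-identityʳ _ ⟩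
      a n                                    ∎

    reduce-Deg≤ : ∀ a n → suc k N.≤ suc n → Deg≤ a (suc n) → Deg≤ (a ⊖ conv g (cancelTop a (suc n))) n
    reduce-Deg≤ a n k<1+n a≤1+n = Deg≤-pred (Deg≤-⊖ a≤1+n (Deg≤-mono (NP.≤-reflexive (NP.m∸n+n≡m k<1+n)) gt≤)) top≈0
      where
      gt≤ = P.subst (Deg≤ _) (NP.+-comm (suc k) _) (conv-Deg≤ (suc k) (suc n N.∸ suc k) g≤ (Deg≤-scale _ (monomial-Deg≤ _)))
      top≈0 = trans (+-congˡ (-‿cong (conv-cancelTop-top a (suc n) k<1+n))) (-‿inverseʳ _)

    divMod : ∀ n a → Deg≤ a n → DivMod a n
    divMod n a a≤n with n N.≤? k
    ... | yes n≤k = 𝟘 , a , Deg≤-𝟘 , Deg≤-mono n≤k a≤n , λ i → sym (trans (+-congʳ (conv-zeroʳ g i)) (+-identityˡ _))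
    divMod zero    a a≤n | no 0≰k = ⊥-elim (0≰k z≤n)
    divMod (suc n) a a≤n | no n≰k with divMod n (a ⊖ conv g (cancelTop a (suc n))) (reduce-Deg≤ a n (NP.≰⇒> n≰k) a≤n)
    ... | q , r , q≤n , r≤k , a′≐gq+r =
      q ⊕ cancelTop a (suc n) , r , Deg≤-⊕ (Deg≤-mono (NP.n≤1+n n) q≤n) (cancelTop-Deg≤ a (suc n)) , r≤k , λ i → begin
        a i                                           ≈⟨ //-rightDividesˡ (conv g t i) (a i) ⟨
        (a i + - conv g t i) + conv g t i             ≈⟨ +-congʳ (a′≐gq+r i) ⟩
        (conv g q i + r i) + conv g t i               ≈⟨ +-assoc _ _ _ ⟩
        conv g q i + (r i + conv g t i)               ≈⟨ +-congˡ (+-comm _ _) ⟩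
        conv g q i + (conv g t i + r i)               ≈⟨ +-assoc _ _ _ ⟨
        (conv g q i + conv g t i) + r i               ≈⟨ +-congʳ (conv-distribˡ-⊕ q t g i) ⟨
        conv g (q ⊕ t) i + r i                        ∎
      where t = cancelTop a (suc n)

  ⊕⇒⊖ : ∀ {a b r} → a ≐ b ⊕ r → r ≐ a ⊖ b
  ⊕⇒⊖ {a} {b} {r} a≐b⊕r i = trans (sym (//-rightDividesʳ (b i) (r i))) (+-congʳ (trans (+-comm _ _) (sym (a≐b⊕r i))))

  remainder-conv : ∀ {a d q r} b → a ≐ conv d q ⊕ r → conv r b ≐ conv a b ⊖ conv q (conv d b)
  remainder-conv {a} {d} {q} {r} b a≐dq⊕r i = begin
    conv r b i                         ≈⟨ conv-congˡ b (⊕⇒⊖ a≐dq⊕r) i ⟩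
    conv (a ⊖ conv d q) b i            ≈⟨ conv-distribʳ-⊖ a (conv d q) b i ⟩
    conv a b i + - conv (conv d q) b i ≈⟨ +-congˡ (-‿cong (trans (conv-congˡ b (conv-comm d q) i) (conv-assoc q d b i))) ⟩
    conv a b i + - conv q (conv d b) i ∎

  infix 4 _∣ˢ_
  _∣ˢ_ : Seq → Seq → Set (c ⊔ ℓ)
  p ∣ˢ w = Σ Seq λ u → Σ ℕ λ n → Deg≤ u n × conv p u ≐ w

  ∣ˢ-respʳ : ∀ {p w w′} → p ∣ˢ w → w ≐ w′ → p ∣ˢ w′
  ∣ˢ-respʳ (u , n , u≤n , pu≐w) w≐w′ = u , n , u≤n , ≐-trans pu≐w w≐w′

  ∣ˢ-refl : ∀ {p b n} → Deg≤ b n → p ∣ˢ conv p b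
  ∣ˢ-refl {b = b} {n} b≤n = b , n , b≤n , ≐-refl

  ∣ˢ-𝟘 : ∀ {p w} → w ≐ 𝟘 → p ∣ˢ w
  ∣ˢ-𝟘 {p} w≐𝟘 = 𝟘 , 0 , Deg≤-𝟘 , ≐-trans (conv-zeroʳ p) (≐-sym w≐𝟘)

  ∣ˢ-⊕ : ∀ {p w w′} → p ∣ˢ w → p ∣ˢ w′ → p ∣ˢ w ⊕ w′
  ∣ˢ-⊕ {p} (u , n , u≤n , pu≐w) (v , m , v≤m , pv≐w′) =
    u ⊕ v , n N.+ m , Deg≤-⊕ (Deg≤-mono (NP.m≤m+n n m) u≤n) (Deg≤-mono (NP.m≤n+m m n) v≤m) ,
    λ i → trans (conv-distribˡ-⊕ u v p i) (+-cong (pu≐w i) (pv≐w′ i))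

  ∣ˢ-⊖ : ∀ {p w w′} → p ∣ˢ w → p ∣ˢ w′ → p ∣ˢ w ⊖ w′
  ∣ˢ-⊖ {p} (u , n , u≤n , pu≐w) (v , m , v≤m , pv≐w′) =
    u ⊖ v , n N.+ m , Deg≤-⊖ (Deg≤-mono (NP.m≤m+n n m) u≤n) (Deg≤-mono (NP.m≤n+m m n) v≤m) ,
    λ i → trans (conv-distribˡ-⊖ u v p i) (+-cong (pu≐w i) (-‿cong (pv≐w′ i)))

  ∣ˢ-convˡ : ∀ {p w} s {n} → Deg≤ s n → p ∣ˢ w → p ∣ˢ conv s w
  ∣ˢ-convˡ {p} {w} s {n} s≤n (u , m , u≤m , pu≐w) = conv s u , n N.+ m , conv-Deg≤ n m s≤n u≤m , λ i → begin
    conv p (conv s u) i  ≈⟨ conv-assoc p s u i ⟨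
    conv (conv p s) u i  ≈⟨ conv-congˡ u (conv-comm p s) i ⟩
    conv (conv s p) u i  ≈⟨ conv-assoc s p u i ⟩
    conv s (conv p u) i  ≈⟨ conv-congʳ s pu≐w i ⟩
    conv s w i           ∎

  ∣⇒∣ˢ : ∀ {e d} {π : HPoly e} {f : HPoly d} → π ∣ f → coeff π ∣ˢ coeff f
  ∣⇒∣ˢ π∣f with ∣-elim π∣f
  ... | m , u , u≤m , πu≐f , _ = u , m , u≤m , πu≐f

  ∣ˢ⇒∣ : ∀ {e d} (π : HPoly e) → ¬ coeff π e ≈ 0# → (f : HPoly d) → coeff π ∣ˢ coeff f → π ∣ f
  ∣ˢ⇒∣ {e} {d} π πtop≉0 f (u , n , u≤n , πu≐f) with degree? d (coeff f) (coeff-Deg≤ f)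
  ... | inj₁ f≐𝟘   = ∣-𝟘 π f f≐𝟘
  ... | inj₂ deg-f with quotient-Deg≤ e d (coeff-Deg≤ π) πtop≉0 (degree? n u u≤n) (coeff-Deg≤ f) πu≐f
  ...   | u≤d-e , e≤d = ∣-fromSeq π f u u≤d-e (NP.m+[n∸m]≡n (e≤d (HasDegree⇒≉𝟘 deg-f))) πu≐f

  -- Induction on the x-degree of a. If deg a ≥ deg π, replace a by its remainder modulo π.
  -- If 0 < deg a < deg π, write π = a s + t with deg t < deg a: then π ∣ t b, and π ∣ t would
  -- force t = 0, making a a proper factor of π.
  module Euclid {e} (π : HPoly (suc e)) (π-irr : Irreducible π) (πtop≉0 : ¬ coeff π (suc e) ≈ 0#) (b : Seq) {nb : ℕ} (b≤ : Deg≤ b nb) where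
    p = coeff π

    EuclidUpTo : ℕ → Set (c ⊔ ℓ)
    EuclidUpTo n = ∀ a → Deg≤ a n → p ∣ˢ conv a b → p ∣ˢ a ⊎ p ∣ˢ b

    noFactorOfMiddleDegree : ∀ a k → ¬ a k ≈ 0# → Deg≤ a k → 0 N.< k → k N.< suc e →
                             ∀ s {ns} → Deg≤ s ns → conv a s ≐ p → ⊥
    noFactorOfMiddleDegree a k ak≉0 a≤k 0<k k<1+e s s≤ as≐p
      with quotient-Deg≤ k (suc e) a≤k ak≉0 (degree? _ s s≤) (coeff-Deg≤ π) as≐p
    ... | s≤′ , k≤1+e with proj₂ π-irr k (fromSeq k a)
             (un∣ (∣-fromSeq (fromSeq k a) π s s≤′ (NP.m+[n∸m]≡n (k≤1+e (irreducible⇒≉𝟘 π π-irr)))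
                             (≐-trans (conv-congˡ s (coeff-fromSeq a≤k)) as≐p)))
    ...   | inj₁ k≡0   = NP.<⇒≢ 0<k (P.sym k≡0)
    ...   | inj₂ k≡1+e = NP.<⇒≢ k<1+e k≡1+e

    lowDegreeMultiple⇒𝟘 : ∀ {t} k → k N.< suc e → Deg≤ t k → p ∣ˢ t → t ≐ 𝟘
    lowDegreeMultiple⇒𝟘 {t} k k<1+e t≤k (v , nv , v≤ , pv≐t) with degree? nv v v≤
    ... | inj₁ v≐𝟘 = ≐-trans (≐-sym pv≐t) (≐-trans (conv-congʳ p v≐𝟘) (conv-zeroʳ p))
    ... | inj₂ (j , vj≉0 , v≤j) = ⊥-elim (*-nonzero πtop≉0 vj≉0 (begin
      p (suc e) * v j            ≈⟨ conv-top (suc e) j (coeff-Deg≤ π) v≤j ⟨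
      conv p v (suc e N.+ j)     ≈⟨ pv≐t _ ⟩
      t (suc e N.+ j)            ≈⟨ t≤k _ (NP.<-≤-trans k<1+e (NP.m≤m+n (suc e) j)) ⟩
      0#                         ∎))

    unitCase : ∀ a → ¬ a 0 ≈ 0# → Deg≤ a 0 → p ∣ˢ conv a b → p ∣ˢ b
    unitCase a a0≉0 a≤0 p∣ab = ∣ˢ-respʳ (∣ˢ-convˡ (constant a0⁻¹) {0} (λ { (suc i) _ → refl }) p∣ab) λ i → begin
      conv (constant a0⁻¹) (conv a b) i        ≈⟨ conv-constantˡ a0⁻¹ (conv a b) i ⟩
      a0⁻¹ * conv a b i                        ≈⟨ *-congˡ (conv-congˡ b (Deg≤0⇒constant a≤0) i) ⟩
      a0⁻¹ * conv (constant (a 0)) b i         ≈⟨ *-congˡ (conv-constantˡ (a 0) b i) ⟩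
      a0⁻¹ * (a 0 * b i)                       ≈⟨ inv-cancelˡ (a 0) a0≉0 (b i) ⟩
      b i                                      ∎
      where a0⁻¹ = inv (a 0) a0≉0

    reduceModπ : ∀ {n} a → Deg≤ a n → EuclidUpTo e → p ∣ˢ conv a b → p ∣ˢ a ⊎ p ∣ˢ b
    reduceModπ {n} a a≤n euclid-e p∣ab = reduce (Modπ.divMod n a a≤n)
      where
      module Modπ = DivisionWithRemainder p e (coeff-Deg≤ π) πtop≉0
      reduce : Modπ.DivMod a n → p ∣ˢ a ⊎ p ∣ˢ b
      reduce (q , r , q≤n , r≤e , a≐pq⊕r) =
        Sum.map₁ (λ p∣r → ∣ˢ-respʳ (∣ˢ-⊕ (∣ˢ-refl q≤n) p∣r) (≐-sym a≐pq⊕r))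
                 (euclid-e r r≤e (∣ˢ-respʳ (∣ˢ-⊖ p∣ab (∣ˢ-convˡ q q≤n (∣ˢ-refl b≤))) (≐-sym (remainder-conv b a≐pq⊕r))))

    lowDegreeCase : ∀ k a → ¬ a (suc k) ≈ 0# → Deg≤ a (suc k) → k N.< e → EuclidUpTo k → p ∣ˢ conv a b → p ∣ˢ b
    lowDegreeCase k a atop≉0 a≤ k<e euclid-k p∣ab = divide (Moda.divMod (suc e) p (coeff-Deg≤ π))
      where
      module Moda = DivisionWithRemainder a k a≤ atop≉0
      divide : Moda.DivMod p (suc e) → p ∣ˢ b
      divide (s , t , s≤ , t≤k , p≐as⊕t) =
        [ ⊥-elim ∘ π∣t⇒⊥ , id ]′
          (euclid-k t t≤k (∣ˢ-respʳ (∣ˢ-⊖ (∣ˢ-refl b≤) (∣ˢ-convˡ s s≤ p∣ab)) (≐-sym (remainder-conv b p≐as⊕t))))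
        where
        π∣t⇒⊥ : p ∣ˢ t → ⊥
        π∣t⇒⊥ p∣t = noFactorOfMiddleDegree a (suc k) atop≉0 a≤ (s≤s z≤n) (s≤s k<e) s s≤ λ i →
          sym (trans (p≐as⊕t i) (trans (+-congˡ (lowDegreeMultiple⇒𝟘 k (NP.m<n⇒m<1+n k<e) t≤k p∣t i)) (+-identityʳ _)))

    euclidˢ : ∀ n → EuclidUpTo n
    euclidˢ = <-rec EuclidUpTo step
      where
      step : ∀ n → (∀ {m} → m N.< n → EuclidUpTo m) → EuclidUpTo n
      step n smaller a a≤n p∣ab with degree? n a a≤n
      ... | inj₁ a≐𝟘                    = inj₁ (∣ˢ-𝟘 a≐𝟘)
      ... | inj₂ (zero , a0≉0 , a≤0)    = inj₂ (unitCase a a0≉0 a≤0 p∣ab)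
      ... | inj₂ (suc k , atop≉0 , a≤) with e N.≤? k
      ...   | yes e≤k = reduceModπ a a≤n (smaller (NP.<-≤-trans (s≤s e≤k) (nonzero⇒≤bound a≤n atop≉0))) p∣ab
      ...   | no  e≰k = inj₂ (lowDegreeCase k a atop≉0 a≤ (NP.≰⇒> e≰k) (smaller (nonzero⇒≤bound a≤n atop≉0)) p∣ab)

  Y-prime : ∀ {da db} (a : HPoly da) (b : HPoly db) → Y ∣ (a *ₚ b) → Y ∣ a ⊎ Y ∣ b
  Y-prime {da} {db} a b Y∣ab with coeff a da ≟ₖ 0# | coeff b db ≟ₖ 0#
  ... | yes atop≈0 | _          = inj₁ (top≈0⇒Y∣ a atop≈0)
  ... | no  _      | yes btop≈0 = inj₂ (top≈0⇒Y∣ b btop≈0)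
  ... | no  atop≉0 | no  btop≉0 = ⊥-elim (*-nonzero atop≉0 btop≉0 (begin
    coeff a da * coeff b db          ≈⟨ conv-top da db (coeff-Deg≤ a) (coeff-Deg≤ b) ⟨
    conv (coeff a) (coeff b) (da N.+ db) ≈⟨ coeff-* a b (da N.+ db) ⟨
    coeff (a *ₚ b) (da N.+ db)       ≈⟨ Y∣⇒top≈0 (a *ₚ b) Y∣ab ⟩
    0#                               ∎))

  irreducible∧top≈0⇒∣Y : ∀ {e} (π : HPoly (suc e)) → Irreducible π → coeff π (suc e) ≈ 0# → π ∣ Y
  irreducible∧top≈0⇒∣Y {e} π π-irr πtop≈0 with proj₂ π-irr 1 Y (un∣ (top≈0⇒Y∣ π πtop≈0))
  ... | inj₂ P.refl = ∣⇒∣-sameDegree Y π (top≈0⇒Y∣ π πtop≈0) (irreducible⇒≉𝟘 π π-irr)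

  -- The descent above measures x-degrees, which equal the homogeneous degree only when y ∤ π.
  euclid : ∀ {e da db} (π : HPoly e) → Irreducible π → (a : HPoly da) (b : HPoly db) → π ∣ (a *ₚ b) → π ∣ a ⊎ π ∣ b
  euclid {zero}  π (0≢0 , _) a b π∣ab = ⊥-elim (0≢0 P.refl)
  euclid {suc e} {da} π π-irr a b π∣ab with coeff π (suc e) ≟ₖ 0#
  ... | yes πtop≈0 = Sum.map (∣-trans π∣Y) (∣-trans π∣Y) (Y-prime a b (∣-trans (∣Y⇒Y∣ π (λ ()) π∣Y) π∣ab))
    where π∣Y = irreducible∧top≈0⇒∣Y π π-irr πtop≈0
  ... | no  πtop≉0 = Sum.map (∣ˢ⇒∣ π πtop≉0 a) (∣ˢ⇒∣ π πtop≉0 b)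
    (Euclid.euclidˢ π π-irr πtop≉0 (coeff b) (coeff-Deg≤ b) da (coeff a) (coeff-Deg≤ a) (∣ˢ-respʳ (∣⇒∣ˢ π∣ab) (coeff-* a b)))

module DivisorDeterminesDivisibility {c ℓ : Level} (𝕜 : FiniteField c ℓ) where
  open EuclidsLemma 𝕜 public

  pow∣-coprime : ∀ {eρ eπ} (ρ : HPoly eρ) → Irreducible ρ → (π : HPoly eπ) → ¬ (ρ ∣ π) →
                 ∀ n {d} (a : HPoly d) → pow ρ n ∣ (π *ₚ a) → pow ρ n ∣ a
  pow∣-coprime ρ ρ-irr π ρ∤π zero    a _ = one∣ a
  pow∣-coprime ρ ρ-irr π ρ∤π (suc n) {d} a ρⁿ⁺¹∣πa
    with euclid ρ ρ-irr π a (∣-trans (∣m⇒∣m*n (pow ρ n) (∣-refl ρ)) ρⁿ⁺¹∣πa)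
  ... | inj₁ ρ∣π = ⊥-elim (ρ∤π ρ∣π)
  ... | inj₂ ρ∣a with degree? d (coeff a) (coeff-Deg≤ a)
  ...   | inj₁ a≐𝟘 = ∣-𝟘 (pow ρ (suc n)) a a≐𝟘
  ...   | inj₂ deg-a with quotient ρ∣a (∣⇒deg≤ ρ∣a (HasDegree⇒≉𝟘 deg-a))
  ...     | a₁ , a≋ρa₁ = ∣-respʳ (*-monoˡ-∣ ρ ρⁿ∣a₁) (≋-sym a≋ρa₁)
    where
    ρⁿ∣a₁ : pow ρ n ∣ a₁
    ρⁿ∣a₁ = pow∣-coprime ρ ρ-irr π ρ∤π n a₁ (*-cancelˡ-∣ ρ (irreducible⇒≉𝟘 ρ ρ-irr)
              (∣-respʳ ρⁿ⁺¹∣πa (≋-trans (*ₚ-cong (≋-refl {f = π}) a≋ρa₁) (*ₚ-swap π ρ a₁))))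

  PrimePowersDivide : ∀ {da db} → HPoly da → HPoly db → Set (c ⊔ ℓ)
  PrimePowersDivide a b = ∀ (P : ClosedPoint) n → pow (ClosedPoint.poly P) n ∣ a → pow (ClosedPoint.poly P) n ∣ b

  PrimePowersDivide-resp : ∀ {da da′ db db′} {a : HPoly da} {a′ : HPoly da′} {b : HPoly db} {b′ : HPoly db′} →
                           a ≋ a′ → b ≋ b′ → PrimePowersDivide a b → PrimePowersDivide a′ b′
  PrimePowersDivide-resp a≋a′ b≋b′ a⇒b P n πⁿ∣a′ = ∣-respʳ (a⇒b P n (∣-respʳ πⁿ∣a′ (≋-sym a≋a′))) b≋b′

  PrimePowersDivide-cancelˡ : ∀ {e da db} (π : HPoly e) → Irreducible π → (a : HPoly da) (b : HPoly db) →
                              PrimePowersDivide (π *ₚ a) (π *ₚ b) → PrimePowersDivide a b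
  PrimePowersDivide-cancelˡ {e} π π-irr a b πa⇒πb Q n ρⁿ∣a = cancel (∣? ρ π)
    where
    ρ = ClosedPoint.poly Q
    ρ-irr = ClosedPoint.irred Q
    cancel : Dec (ρ ∣ π) → pow ρ n ∣ b
    cancel (no ρ∤π) = pow∣-coprime ρ ρ-irr π ρ∤π n b (πa⇒πb Q n (∣n⇒∣m*n π ρⁿ∣a))
    cancel (yes ρ∣π) = *-cancelˡ-∣ ρ (irreducible⇒≉𝟘 ρ ρ-irr)
      (∣-trans (πa⇒πb Q (suc n) (*-pres-∣ ρ∣π ρⁿ∣a)) (*-pres-∣ (π∣ρ (proj₂ π-irr _ ρ (un∣ ρ∣π))) (∣-refl b)))
      where
      π∣ρ : (ClosedPoint.deg Q ≡ 0) ⊎ (ClosedPoint.deg Q ≡ e) → π ∣ ρ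
      π∣ρ (inj₁ deg-ρ≡0) = ⊥-elim (proj₁ ρ-irr deg-ρ≡0)
      π∣ρ (inj₂ P.refl)  = ∣⇒∣-sameDegree ρ π ρ∣π (irreducible⇒≉𝟘 π π-irr)

  PrimePowerCriterion : ℕ → Set (c ⊔ ℓ)
  PrimePowerCriterion da = ∀ {db} (a : HPoly da) (b : HPoly db) → ¬ (coeff a ≐ 𝟘) → PrimePowersDivide a b → a ∣ b

  divideOutFactor : ∀ {e da db} (π : HPoly e) → Irreducible π → Monic π → (∀ {d₁} → d₁ N.< da → PrimePowerCriterion d₁) →
                    (a : HPoly da) (b : HPoly db) → ¬ (coeff a ≐ 𝟘) → ¬ (coeff b ≐ 𝟘) → PrimePowersDivide a b → π ∣ a → a ∣ b
  divideOutFactor {e} {da} {db} π π-irr π-monic smaller a b a≉𝟘 b≉𝟘 a⇒b π∣a =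
    divide (quotient π∣a (∣⇒deg≤ π∣a a≉𝟘)) (quotient π∣b (∣⇒deg≤ π∣b b≉𝟘))
    where
    P = record { poly = π ; monic = π-monic ; irred = π-irr }
    π∣b : π ∣ b
    π∣b = ∣-respˡ (*ₚ-identityʳ π) (a⇒b P 1 (∣-respˡ (≋-sym (*ₚ-identityʳ π)) π∣a))
    divide : Σ (HPoly (da N.∸ e)) (λ a₁ → a ≋ (π *ₚ a₁)) → Σ (HPoly (db N.∸ e)) (λ b₁ → b ≋ (π *ₚ b₁)) → a ∣ b
    divide (a₁ , a≋πa₁) (b₁ , b≋πb₁) = ∣-respˡ (≋-sym a≋πa₁) (∣-respʳ (*-monoˡ-∣ π a₁∣b₁) (≋-sym b≋πb₁))
      where
      a₁∣b₁ : a₁ ∣ b₁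
      a₁∣b₁ = smaller (NP.∸-monoʳ-< (NP.n≢0⇒n>0 (proj₁ π-irr)) (∣⇒deg≤ π∣a a≉𝟘)) a₁ b₁
        (λ a₁≐𝟘 → a≉𝟘 (≐-trans (≋⇒≐ a≋πa₁) (*ₚ-zeroʳ π a₁ a₁≐𝟘)))
        (PrimePowersDivide-cancelˡ π π-irr a₁ b₁ (PrimePowersDivide-resp a≋πa₁ b≋πb₁ a⇒b))

  primePowersDivide⇒∣ : ∀ {da} → PrimePowerCriterion da
  primePowersDivide⇒∣ {da} = <-rec PrimePowerCriterion step da
    where
    step : ∀ da → (∀ {d₁} → d₁ N.< da → PrimePowerCriterion d₁) → PrimePowerCriterion da
    step da smaller {db} a b a≉𝟘 a⇒b with degree? db (coeff b) (coeff-Deg≤ b) | da N.≟ 0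
    ... | inj₁ b≐𝟘   | _         = ∣-𝟘 a b b≐𝟘
    ... | inj₂ _     | yes da≡0 = nonzeroConstant∣ a b da≡0 a≉𝟘
    ... | inj₂ deg-b | no  da≢0 =
      let (_ , π , π-monic , π-irr , π∣a) = monicIrreducibleFactor a a≉𝟘 da≢0
      in divideOutFactor π π-irr π-monic smaller a b a≉𝟘 (HasDegree⇒≉𝟘 deg-b) a⇒b π∣a

module FixedPoints {c ℓ : Level} (𝕜 : FiniteField c ℓ) where
  open DivisorDeterminesDivisibility 𝕜 public
  open import Relation.Binary.Reasoning.Setoid setoid
  open import Algebra.Properties.AbelianGroup +-abelianGroup using (⁻¹-anti-homo‿-)
  open import Algebra.Properties.Group +-group using (//-rightDividesˡ)
  open import Algebra.Properties.Ring (CommutativeRing.ring commRing) using (-1*x≈-x; -0#≈0#)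

  x-[x-y]≈y : ∀ x y → x + - (x + - y) ≈ y
  x-[x-y]≈y x y = trans (+-congˡ (⁻¹-anti-homo‿- x y)) (trans (+-comm _ _) (//-rightDividesˡ x y))

  sameDivisors⇒≡Div : ∀ {d e} {f : HPoly d} {g : HPoly e} →
                      (∀ {m} (q : HPoly m) → q ∣ f → q ∣ g) → (∀ {m} (q : HPoly m) → q ∣ g → q ∣ f) → f ≡Div g
  sameDivisors⇒≡Div {f = f} {g} f⇒g g⇒f P n = mk⇔ (transfer f⇒g g⇒f) (transfer g⇒f f⇒g)
    where
    πⁿ = pow (ClosedPoint.poly P) n
    πⁿ⁺¹ = pow (ClosedPoint.poly P) (suc n)
    transfer : ∀ {d e} {a : HPoly d} {b : HPoly e} →
               (∀ {m} (q : HPoly m) → q ∣ a → q ∣ b) → (∀ {m} (q : HPoly m) → q ∣ b → q ∣ a) → Ord P a n → Ord P b n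
    transfer {a = a} {b} a⇒b b⇒a (πⁿ∣a , πⁿ⁺¹∤a) =
      un∣ (a⇒b πⁿ (mk∣ {q = πⁿ} {f = a} πⁿ∣a)) ,
      λ πⁿ⁺¹∣b → πⁿ⁺¹∤a (un∣ (b⇒a πⁿ⁺¹ (mk∣ {q = πⁿ⁺¹} {f = b} πⁿ⁺¹∣b)))

  ≋⇒≡Div : ∀ {d e} {f : HPoly d} {g : HPoly e} → f ≋ g → f ≡Div g
  ≋⇒≡Div f≋g = sameDivisors⇒≡Div (λ q q∣f → ∣-respʳ q∣f f≋g) (λ q q∣g → ∣-respʳ q∣g (≋-sym f≋g))

  ·ₚ-≡Div : ∀ {d} (f : HPoly d) {a} → ¬ a ≈ 0# → (a ·ₚ f) ≡Div f
  ·ₚ-≡Div f {a} a≉0 = sameDivisors⇒≡Div (λ q → ∣-unscale {f = f} a a≉0) (λ q → ∣-·ₚ {f = f} a)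

  ≡Div-trans : ∀ {d e k} {f : HPoly d} {g : HPoly e} {h : HPoly k} → f ≡Div g → g ≡Div h → f ≡Div h
  ≡Div-trans f≡g g≡h P n = ⇔.trans (f≡g P n) (g≡h P n)

  Coprime-·ₚ : ∀ {d e} {f : HPoly d} {g : HPoly e} x → ¬ x ≈ 0# → Coprime f g → Coprime (x ·ₚ f) (x ·ₚ g)
  Coprime-·ₚ {f = f} {g} x x≉0 f⊥g m q q∣xf q∣xg =
    f⊥g m q (un∣ (∣-unscale {q = q} {f = f} x x≉0 (mk∣ q∣xf))) (un∣ (∣-unscale {q = q} {f = g} x x≉0 (mk∣ q∣xg)))

  Coprime⇒¬commonIrreducible : ∀ {d e k} {f : HPoly d} {g : HPoly e} → Coprime f g →
                               (π : HPoly k) → Irreducible π → π ∣ f → π ∣ g → ⊥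
  Coprime⇒¬commonIrreducible f⊥g π π-irr π∣f π∣g = proj₁ π-irr (f⊥g _ π (un∣ π∣f) (un∣ π∣g))

  ¬commonIrreducible⇒Coprime : ∀ {d e} (f : HPoly d) (g : HPoly e) → ¬ (coeff f ≐ 𝟘) →
                               (∀ {k} (π : HPoly k) → Irreducible π → π ∣ f → π ∣ g → ⊥) → Coprime f g
  ¬commonIrreducible⇒Coprime f g f≉𝟘 none m q q∣f q∣g with m N.≟ 0
  ... | yes m≡0 = m≡0
  ... | no  m≢0 with irreducibleFactor q (∣-nonzero (mk∣ {q = q} {f = f} q∣f) f≉𝟘) m≢0
  ...   | _ , π , π-irr , π∣q = ⊥-elim (none π π-irr (∣-trans π∣q (mk∣ {q = q} {f = f} q∣f)) (∣-trans π∣q (mk∣ {q = q} {f = g} q∣g)))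

  monic∧Y∤⇒top≈1 : ∀ {d} (w : HPoly d) → Monic w → ¬ (Y ∣ w) → coeff w d ≈ 1#
  monic∧Y∤⇒top≈1 {d} w (i , wi≈1 , w≤i) Y∤w with NP.<-cmp i d
  ... | tri< i<d _ _ = ⊥-elim (Y∤w (top≈0⇒Y∣ w (w≤i d i<d)))
  ... | tri≈ _ P.refl _ = wi≈1
  ... | tri> _ _ d<i = ⊥-elim (1≉0 (trans (sym wi≈1) (coeff-Deg≤ w i d<i)))

  fixedPointPoly : ∀ {s} → RatFun s → HPoly (suc s)
  fixedPointPoly F = (X *ₚ RatFun.den F) -ₚ (Y *ₚ RatFun.num F)

  coeff-fixedPointPoly : ∀ {s} (F : RatFun s) → coeff (fixedPointPoly F) ≐ shift (coeff (RatFun.den F)) ⊖ coeff (RatFun.num F)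
  coeff-fixedPointPoly F i = trans (coeff-sub (X *ₚ RatFun.den F) (Y *ₚ RatFun.num F) i)
                                   (+-cong (coeff-X* (RatFun.den F) i) (-‿cong (coeff-Y* (RatFun.num F) i)))

  IsXoverY⇔fixedPointPoly≐𝟘 : ∀ {s} (F : RatFun s) → IsXoverY F ⇔ (coeff (fixedPointPoly F) ≐ 𝟘)
  IsXoverY⇔fixedPointPoly≐𝟘 {s} F = mk⇔
    (λ gY≈Xh i → trans (coeff-fixedPointPoly F i) (x≈y⇒x∙y⁻¹≈ε (sym (gY≐Xh gY≈Xh i))))
    (λ fix≐𝟘 → ≐⇒≈ₚ (g *ₚ Y) (X *ₚ h) (NP.+-comm s 1) λ i →
       trans (coeff-*Y g i) (sym (trans (coeff-X* h i) (x∙y⁻¹≈ε⇒x≈y _ _ (trans (sym (coeff-fixedPointPoly F i)) (fix≐𝟘 i))))))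
    where
    open import Algebra.Properties.Group +-group using (x∙y⁻¹≈ε⇒x≈y; x≈y⇒x∙y⁻¹≈ε)
    g = RatFun.num F
    h = RatFun.den F
    gY≐Xh : (g *ₚ Y) ≈ₚ (X *ₚ h) → coeff g ≐ shift (coeff h)
    gY≐Xh gY≈Xh = ≐-trans (≐-sym (coeff-*Y g)) (≐-trans (≈ₚ⇒≐ (g *ₚ Y) (X *ₚ h) gY≈Xh) (coeff-X* h))

  ≈F-rescaled : ∀ {s} (F : RatFun s) x (w : HPoly (suc s)) (H : HPoly s) →
                coeff w ≐ scale x (coeff (RatFun.num F)) → coeff H ≐ scale x (coeff (RatFun.den F)) → F ≈F w / (Y *ₚ H)
  ≈F-rescaled {s} F x w H w≐xg H≐xh = ≐⇒≈ₚ (g *ₚ (Y *ₚ H)) (w *ₚ h) (NP.+-comm s (suc s)) λ i → begin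
    coeff (g *ₚ (Y *ₚ H)) i              ≈⟨ coeff-* g (Y *ₚ H) i ⟩
    conv (coeff g) (coeff (Y *ₚ H)) i    ≈⟨ conv-congʳ (coeff g) (≐-trans (coeff-Y* H) H≐xh) i ⟩
    conv (coeff g) (scale x (coeff h)) i ≈⟨ conv-scaleʳ x (coeff g) (coeff h) i ⟩
    x * conv (coeff g) (coeff h) i       ≈⟨ conv-scaleˡ x (coeff g) (coeff h) i ⟨
    conv (scale x (coeff g)) (coeff h) i ≈⟨ conv-congˡ (coeff h) w≐xg i ⟨
    conv (coeff w) (coeff h) i           ≈⟨ coeff-* w h i ⟨
    coeff (w *ₚ h) i                     ∎
    where
    g = RatFun.num F
    h = RatFun.den F

  fixedPointPoly-top : ∀ {s} (F : RatFun s) → coeff (fixedPointPoly F) (suc s) ≈ coeff (RatFun.den F) s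
  fixedPointPoly-top {s} F = trans (coeff-fixedPointPoly F (suc s))
    (trans (+-congˡ (trans (-‿cong (coeff-Deg≤ (RatFun.num F) (suc s) (NP.n<1+n s))) -0#≈0#)) (+-identityʳ _))

  -- Only for s > 0: a constant numerator over the zero denominator counts as a RatFun 0.
  den≉𝟘 : ∀ {s} (F : RatFun (suc s)) → ¬ (coeff (RatFun.den F) ≐ 𝟘)
  den≉𝟘 F den≐𝟘 = NP.1+n≢0 (RatFun.coprime F _ g (un∣ (∣-refl g)) (un∣ (∣-𝟘 g (RatFun.den F) den≐𝟘)))
    where g = RatFun.num F

  ∣-X*-Y* : ∀ {m s} {q : HPoly m} {h g : HPoly s} → q ∣ h → q ∣ g → q ∣ ((X *ₚ h) -ₚ (Y *ₚ g))
  ∣-X*-Y* q∣h q∣g = ∣-sub (∣n⇒∣m*n X q∣h) (∣n⇒∣m*n Y q∣g)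

  -ₚ-swap : ∀ {d} (f a b : HPoly d) → (f -ₚ a) ≋ b → (f -ₚ b) ≋ a
  -ₚ-swap f a b f-a≋b = ≋-byCoeff P.refl λ i → begin
    coeff (f -ₚ b) i                   ≈⟨ coeff-sub f b i ⟩
    coeff f i + - coeff b i            ≈⟨ +-congˡ (-‿cong (≋⇒≐ f-a≋b i)) ⟨
    coeff f i + - coeff (f -ₚ a) i     ≈⟨ +-congˡ (-‿cong (coeff-sub f a i)) ⟩
    coeff f i + - (coeff f i + - coeff a i) ≈⟨ x-[x-y]≈y _ _ ⟩
    coeff a i                          ∎

  -ₚ-anticomm : ∀ {d} (f g : HPoly d) → (f -ₚ g) ≋ ((- 1#) ·ₚ (g -ₚ f))
  -ₚ-anticomm f g = ≋-byCoeff P.refl λ i → begin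
    coeff (f -ₚ g) i                   ≈⟨ coeff-sub f g i ⟩
    coeff f i + - coeff g i            ≈⟨ ⁻¹-anti-homo‿- (coeff g i) (coeff f i) ⟨
    - (coeff g i + - coeff f i)        ≈⟨ -‿cong (coeff-sub g f i) ⟨
    - coeff (g -ₚ f) i                 ≈⟨ -1*x≈-x _ ⟨
    - 1# * coeff (g -ₚ f) i            ≈⟨ coeff-· (- 1#) (g -ₚ f) i ⟨
    coeff ((- 1#) ·ₚ (g -ₚ f)) i       ∎

  Coprime⇒commonDivisor∣Y : ∀ {s} {g h : HPoly s} → Coprime g h → ¬ (coeff h ≐ 𝟘) →
                            ∀ {m} (q : HPoly m) → q ∣ h → q ∣ (Y *ₚ g) → q ∣ Y
  Coprime⇒commonDivisor∣Y {g = g} g⊥h h≉𝟘 {m} q q∣h q∣Yg = byDegree (m N.≟ 0)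
    where
    q≉𝟘 = ∣-nonzero q∣h h≉𝟘
    Y∣q⇒q∣Y : ¬ m ≡ 0 → Y ∣ q → q ∣ Y
    Y∣q⇒q∣Y m≢0 Y∣q = fromQuotient (quotient Y∣q (NP.n≢0⇒n>0 m≢0))
      where
      fromQuotient : Σ (HPoly (m N.∸ 1)) (λ q₁ → q ≋ (Y *ₚ q₁)) → q ∣ Y
      fromQuotient (q₁ , q≋Yq₁) =
        ∣-respˡ (≋-sym q≋Yq₁) (∣-respʳ (*-monoˡ-∣ Y (nonzeroConstant∣ q₁ one deg-q₁≡0 q₁≉𝟘)) (*ₚ-identityʳ Y))
        where
        q₁≉𝟘 : ¬ (coeff q₁ ≐ 𝟘)
        q₁≉𝟘 q₁≐𝟘 = q≉𝟘 (≐-trans (≋⇒≐ q≋Yq₁) (*ₚ-zeroʳ Y q₁ q₁≐𝟘))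
        q₁∣g = *-cancelˡ-∣ Y {a = q₁} {b = g} Y≉𝟘 (∣-respˡ q≋Yq₁ q∣Yg)
        q₁∣h = ∣-trans (∣-respʳ (∣n⇒∣m*n Y (∣-refl q₁)) (≋-sym q≋Yq₁)) q∣h
        deg-q₁≡0 = g⊥h _ q₁ (un∣ q₁∣g) (un∣ q₁∣h)
    byDegree : Dec (m ≡ 0) → q ∣ Y
    byDegree (yes m≡0) = nonzeroConstant∣ q Y m≡0 q≉𝟘
    byDegree (no  m≢0) =
      let (_ , π , π-irr , π∣q) = irreducibleFactor q q≉𝟘 m≢0
      in [ (λ π∣Y → Y∣q⇒q∣Y m≢0 (∣-trans (∣Y⇒Y∣ π (proj₁ π-irr) π∣Y) π∣q)) ,
           (λ π∣g → ⊥-elim (Coprime⇒¬commonIrreducible g⊥h π π-irr π∣g (∣-trans π∣q q∣h))) ]′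
         (euclid π π-irr Y g (∣-trans π∣q q∣Yg))

  module Parametrisation (r′ : ℕ) (p : HPoly (suc (suc r′))) (p-monic : Monic p) where
    r = suc r′

    p≉𝟘 : ¬ (coeff p ≐ 𝟘)
    p≉𝟘 = monic⇒≉𝟘 p p-monic

    p∣fixedPointPoly : (F : RatFun r) → fixedPointPoly F ≡Div p → p ∣ fixedPointPoly F
    p∣fixedPointPoly F fix≡p = primePowersDivide⇒∣ p (fixedPointPoly F) p≉𝟘 (≡Div⇒pow∣ p (fixedPointPoly F) p≉𝟘 fix≡p)

    record Proportional (F : RatFun r) : Set (c ⊔ ℓ) where
      field
        k      : Carrier
        k≉0    : ¬ k ≈ 0#
        fix≐kp : coeff (fixedPointPoly F) ≐ scale k (coeff p)

    fixedDivisor⇒proportional : (F : RatFun r) → FixDivIs F p → Proportional F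
    fixedDivisor⇒proportional F (F≉X/Y , fix≡p) = record { k = k ; k≉0 = k≉0 ; fix≐kp = fix≐kp }
      where
      multiple = ∣-sameDegree⇒multiple (p∣fixedPointPoly F fix≡p)
      k = proj₁ multiple
      fix≐kp = proj₂ multiple
      k≉0 : ¬ k ≈ 0#
      k≉0 k≈0 = F≉X/Y (Equivalence.from (IsXoverY⇔fixedPointPoly≐𝟘 F) λ i → trans (fix≐kp i) (trans (*-congʳ k≈0) (zeroˡ _)))

    normalise : (F : RatFun r) {k : Carrier} → coeff (fixedPointPoly F) ≐ scale k (coeff p) →
                ∀ x (A : HPoly (suc r)) → coeff A ≐ scale (x * k) (coeff p) →
                ((X *ₚ (x ·ₚ RatFun.den F)) -ₚ A) ≋ (Y *ₚ (x ·ₚ RatFun.num F))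
                × F ≈F ((X *ₚ (x ·ₚ RatFun.den F)) -ₚ A) / (Y *ₚ (x ·ₚ RatFun.den F))
    normalise F {k} fix≐kp x A A≐xkp =
      ≋-byCoeff P.refl (≐-trans w≐xg (≐-sym (≐-trans (coeff-Y* (x ·ₚ g′)) (coeff-· x g′)))) ,
      ≈F-rescaled F x w (x ·ₚ h′) w≐xg (coeff-· x h′)
      where
      open import Algebra.Properties.RingWithoutOne (Ring.ringWithoutOne (CommutativeRing.ring commRing)) using (x[y-z]≈xy-xz)
      g′ = RatFun.num F
      h′ = RatFun.den F
      w = (X *ₚ (x ·ₚ h′)) -ₚ A
      shift-xh′ : ∀ i → shift (coeff (x ·ₚ h′)) i ≈ x * shift (coeff h′) i
      shift-xh′ zero    = sym (zeroʳ x)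
      shift-xh′ (suc i) = coeff-· x h′ i
      w≐xg : coeff w ≐ scale x (coeff g′)
      w≐xg i = begin
        coeff w i                                                    ≈⟨ coeff-sub (X *ₚ (x ·ₚ h′)) A i ⟩
        coeff (X *ₚ (x ·ₚ h′)) i + - coeff A i                       ≈⟨ +-cong (trans (coeff-X* (x ·ₚ h′) i) (shift-xh′ i)) (-‿cong (A≐xkp i)) ⟩
        x * shift (coeff h′) i + - ((x * k) * coeff p i)             ≈⟨ +-congˡ (-‿cong (trans (*-assoc _ _ _) (*-congˡ (sym (fix≐kp i))))) ⟩
        x * shift (coeff h′) i + - (x * coeff (fixedPointPoly F) i)  ≈⟨ x[y-z]≈xy-xz x _ _ ⟨
        x * (shift (coeff h′) i + - coeff (fixedPointPoly F) i)      ≈⟨ *-congˡ (+-congˡ (-‿cong (coeff-fixedPointPoly F i))) ⟩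
        x * (shift (coeff h′) i + - (shift (coeff h′) i + - coeff g′ i)) ≈⟨ *-congˡ (x-[x-y]≈y _ _) ⟩
        x * coeff g′ i                                               ∎

    fromFixedPointPoly : (h : HPoly r) (A : HPoly (suc r)) → ¬ (coeff A ≐ 𝟘) → A ≡Div p → Y ∣ ((X *ₚ h) -ₚ A) →
                         ((g : HPoly r) → ((X *ₚ h) -ₚ (Y *ₚ g)) ≋ A → Coprime g h) →
                         Σ (RatFun r) λ F → FixDivIs F p × F ≈F ((X *ₚ h) -ₚ A) / (Y *ₚ h)
    fromFixedPointPoly h A A≉𝟘 A≡p Y∣w coprime = fromQuotient (quotient Y∣w (s≤s z≤n))
      where
      fromQuotient : Σ (HPoly r) (λ g → ((X *ₚ h) -ₚ A) ≋ (Y *ₚ g)) →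
                     Σ (RatFun r) λ F → FixDivIs F p × F ≈F ((X *ₚ h) -ₚ A) / (Y *ₚ h)
      fromQuotient (g , w≋Yg) = F , (F≉X/Y , ≡Div-trans {f = fixedPointPoly F} {g = A} {h = p} (≋⇒≡Div fix≋A) A≡p) ,
        ≈F-rescaled F 1# ((X *ₚ h) -ₚ A) h (λ i → trans (≋⇒≐ w≋Yg i) (trans (coeff-Y* g i) (sym (*-identityˡ _))))
                                           (λ i → sym (*-identityˡ _))
        where
        fix≋A = -ₚ-swap (X *ₚ h) A (Y *ₚ g) w≋Yg
        F : RatFun r
        F = g / h ∶ coprime g fix≋A
        F≉X/Y : ¬ IsXoverY F
        F≉X/Y F≈X/Y = A≉𝟘 (≐-trans (≐-sym (≋⇒≐ fix≋A)) (Equivalence.to (IsXoverY⇔fixedPointPoly≐𝟘 F) F≈X/Y))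

    module _ (Y∤p : ¬ ∞∈supp p) where

      ptop≈1 : coeff p (suc r) ≈ 1#
      ptop≈1 = monic∧Y∤⇒top≈1 p p-monic (λ Y∣p → Y∤p (un∣ Y∣p))

      forward₁ : (F : RatFun r) → FixDivIs F p →
                 Σ (HPoly r) λ h → Monic h × Coprime h (Y *ₚ p) × F ≈F ((X *ₚ h) -ₚ p) / (Y *ₚ h)
      forward₁ F fix = h , h-monic , h⊥Yp , proj₂ normal
        where
        open Proportional (fixedDivisor⇒proportional F fix)
        x = inv k k≉0
        h = x ·ₚ RatFun.den F
        g = x ·ₚ RatFun.num F
        normal = normalise F fix≐kp x p (λ i → sym (trans (*-congʳ (inv-inverseˡ k k≉0)) (*-identityˡ _)))
        htop≈1 : coeff h r ≈ 1#
        htop≈1 = begin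
          coeff h r                          ≈⟨ coeff-· x (RatFun.den F) r ⟩
          x * coeff (RatFun.den F) r         ≈⟨ *-congˡ (fixedPointPoly-top F) ⟨
          x * coeff (fixedPointPoly F) (suc r) ≈⟨ *-congˡ (trans (fix≐kp (suc r)) (trans (*-congˡ ptop≈1) (*-identityʳ k))) ⟩
          x * k                              ≈⟨ inv-inverseˡ k k≉0 ⟩
          1#                                 ∎
        h-monic : Monic h
        h-monic = r , htop≈1 , coeff-Deg≤ h
        Y∤h : ¬ (Y ∣ h)
        Y∤h Y∣h = 1≉0 (trans (sym htop≈1) (Y∣⇒top≈0 h Y∣h))
        g⊥h : Coprime g h
        g⊥h = Coprime-·ₚ {f = RatFun.num F} {g = RatFun.den F} x (inv-nonzero k k≉0) (RatFun.coprime F)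
        h⊥Yp : Coprime h (Y *ₚ p)
        h⊥Yp = ¬commonIrreducible⇒Coprime h (Y *ₚ p) (monic⇒≉𝟘 h h-monic) noCommonFactor
          where
          noCommonFactor : ∀ {e} (π : HPoly e) → Irreducible π → π ∣ h → π ∣ (Y *ₚ p) → ⊥
          noCommonFactor π π-irr π∣h π∣Yp = [ π∤Y , π∤p ]′ (euclid π π-irr Y p π∣Yp)
            where
            π∤Y : ¬ (π ∣ Y)
            π∤Y π∣Y = Y∤h (∣-trans (∣Y⇒Y∣ π (proj₁ π-irr) π∣Y) π∣h)
            π∤p : ¬ (π ∣ p)
            π∤p π∣p = [ π∤Y , (λ π∣g → Coprime⇒¬commonIrreducible g⊥h π π-irr π∣g π∣h) ]′
                        (euclid π π-irr Y g (∣-respʳ (∣-sub (∣n⇒∣m*n X π∣h) π∣p) (proj₁ normal)))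

      backward₁ : (h : HPoly r) → Monic h → Coprime h (Y *ₚ p) →
                  Σ (RatFun r) λ F → FixDivIs F p × F ≈F ((X *ₚ h) -ₚ p) / (Y *ₚ h)
      backward₁ h h-monic h⊥Yp = fromFixedPointPoly h p p≉𝟘 (≋⇒≡Div (≋-refl {f = p})) (top≈0⇒Y∣ _ wtop≈0) g⊥h
        where
        htop≈1 : coeff h r ≈ 1#
        htop≈1 = monic∧Y∤⇒top≈1 h h-monic (λ Y∣h → NP.1+n≢0 (h⊥Yp 1 Y (un∣ Y∣h) (un∣ (∣m⇒∣m*n p (∣-refl Y)))))
        wtop≈0 : coeff ((X *ₚ h) -ₚ p) (suc r) ≈ 0#
        wtop≈0 = trans (coeff-sub (X *ₚ h) p (suc r))
                       (trans (+-cong (trans (coeff-X* h (suc r)) htop≈1) (-‿cong ptop≈1)) (-‿inverseʳ 1#))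
        g⊥h : (g : HPoly r) → ((X *ₚ h) -ₚ (Y *ₚ g)) ≋ p → Coprime g h
        g⊥h g fix≋p m q q∣g q∣h =
          h⊥Yp m q q∣h (un∣ (∣n⇒∣m*n Y (∣-respʳ (∣-X*-Y* (mk∣ {q = q} {f = h} q∣h) (mk∣ {q = q} {f = g} q∣g)) fix≋p)))

    module _ (Y∣p : ∞∈supp p) where

      forward₂ : (F : RatFun r) → FixDivIs F p →
                 Σ (HPoly r) λ h → Σ Carrier λ a → Monic h × IsGcd Y h p
                   × ¬ (a ≈ 0#) × ¬ ((Y *ₚ Y) ∣ₚ ((a ·ₚ p) -ₚ (X *ₚ h)))
                   × F ≈F ((X *ₚ h) -ₚ (a ·ₚ p)) / (Y *ₚ h)
      forward₂ F fix = h , a , h-monic , (un∣ Y∣h , Y∣p , common⇒∣Y) , *-nonzero x≉0 k≉0 , Y²∤ , proj₂ normal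
        where
        open Proportional (fixedDivisor⇒proportional F fix)
        scaling = monicMultiple (RatFun.den F) (den≉𝟘 F)
        x = proj₁ scaling
        x≉0 = proj₁ (proj₂ scaling)
        a = x * k
        h = x ·ₚ RatFun.den F
        g = x ·ₚ RatFun.num F
        normal = normalise F fix≐kp x (a ·ₚ p) (coeff-· a p)
        g⊥h : Coprime g h
        g⊥h = Coprime-·ₚ {f = RatFun.num F} {g = RatFun.den F} x x≉0 (RatFun.coprime F)
        h-monic : Monic h
        h-monic = proj₂ (proj₂ scaling)
        Y∣h : Y ∣ h
        Y∣h = top≈0⇒Y∣ h (begin
          coeff h r                            ≈⟨ coeff-· x (RatFun.den F) r ⟩
          x * coeff (RatFun.den F) r           ≈⟨ *-congˡ (fixedPointPoly-top F) ⟨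
          x * coeff (fixedPointPoly F) (suc r) ≈⟨ *-congˡ (trans (fix≐kp (suc r)) (trans (*-congˡ (Y∣⇒top≈0 p (mk∣ Y∣p))) (zeroʳ k))) ⟩
          x * 0#                               ≈⟨ zeroʳ x ⟩
          0#                                   ∎)
        Y∤g : ¬ (Y ∣ g)
        Y∤g Y∣g = NP.1+n≢0 (g⊥h 1 Y (un∣ Y∣g) (un∣ Y∣h))
        common⇒∣Y : ∀ m (q : HPoly m) → q ∣ₚ h → q ∣ₚ p → q ∣ₚ Y
        common⇒∣Y m q q∣ₚh q∣ₚp = un∣ (Coprime⇒commonDivisor∣Y {g = g} {h = h} g⊥h (monic⇒≉𝟘 h h-monic) q q∣h
                                        (∣-respʳ (∣-sub (∣n⇒∣m*n X q∣h) (∣-·ₚ a (mk∣ {q = q} {f = p} q∣ₚp))) (proj₁ normal)))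
          where q∣h = mk∣ {q = q} {f = h} q∣ₚh
        Y²∤ : ¬ ((Y *ₚ Y) ∣ₚ ((a ·ₚ p) -ₚ (X *ₚ h)))
        Y²∤ Y²∣ = Y∤g (*-cancelˡ-∣ Y Y≉𝟘 (∣-respʳ (∣-·ₚ (- 1#) (mk∣ Y²∣))
                    (≋-trans (≋-sym (-ₚ-anticomm (X *ₚ h) (a ·ₚ p))) (proj₁ normal))))

      backward₂ : (h : HPoly r) (a : Carrier) → Monic h → IsGcd Y h p →
                  ¬ (a ≈ 0#) → ¬ ((Y *ₚ Y) ∣ₚ ((a ·ₚ p) -ₚ (X *ₚ h))) →
                  Σ (RatFun r) λ F → FixDivIs F p × F ≈F ((X *ₚ h) -ₚ (a ·ₚ p)) / (Y *ₚ h)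
      backward₂ h a h-monic (Y∣h , _ , common⇒∣Y) a≉0 Y²∤ =
        fromFixedPointPoly h (a ·ₚ p) ap≉𝟘 (·ₚ-≡Div p a≉0)
          (∣-sub (∣n⇒∣m*n X (mk∣ {q = Y} {f = h} Y∣h)) (∣-·ₚ a (mk∣ {q = Y} {f = p} Y∣p))) g⊥h
        where
        ap≉𝟘 : ¬ (coeff (a ·ₚ p) ≐ 𝟘)
        ap≉𝟘 ap≐𝟘 = p≉𝟘 λ i →
          trans (sym (inv-cancelˡ a a≉0 (coeff p i))) (trans (*-congˡ (trans (sym (coeff-· a p i)) (ap≐𝟘 i))) (zeroʳ _))
        g⊥h : (g : HPoly r) → ((X *ₚ h) -ₚ (Y *ₚ g)) ≋ (a ·ₚ p) → Coprime g h
        g⊥h g fix≋ap m q q∣g q∣h with m N.≟ 0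
        ... | yes m≡0 = m≡0
        ... | no  m≢0 =
          ⊥-elim (Y²∤ (un∣ (∣-respʳ (∣-·ₚ (- 1#) (∣-respʳ (*-monoˡ-∣ Y Y∣g) Yg≋w)) (≋-sym (-ₚ-anticomm (a ·ₚ p) (X *ₚ h))))))
          where
          q∣p = ∣-unscale a a≉0 (∣-respʳ (∣-X*-Y* (mk∣ {q = q} {f = h} q∣h) (mk∣ {q = q} {f = g} q∣g)) fix≋ap)
          Y∣g = ∣-trans (∣Y⇒Y∣ q m≢0 (mk∣ {q = q} {f = Y} (common⇒∣Y m q q∣h (un∣ q∣p)))) (mk∣ {q = q} {f = g} q∣g)
          Yg≋w = ≋-sym (-ₚ-swap (X *ₚ h) (Y *ₚ g) (a ·ₚ p) fix≋ap)

proposition2p6 : ∀ {c ℓ} (𝕜 : FiniteField c ℓ) →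
    let open HomPoly 𝕜 in
    (r : ℕ) → 1 ≤ r → (p : HPoly (suc r)) → Monic p →
    (¬ ∞∈supp p →
      ((F : RatFun r) → FixDivIs F p →
        Σ (HPoly r) λ h → Monic h × Coprime h (Y *ₚ p)
          × F ≈F ((X *ₚ h) -ₚ p) / (Y *ₚ h))
      × ((h : HPoly r) → Monic h → Coprime h (Y *ₚ p) →
        Σ (RatFun r) λ F → FixDivIs F p
          × F ≈F ((X *ₚ h) -ₚ p) / (Y *ₚ h)))
    ×
    (∞∈supp p →
      ((F : RatFun r) → FixDivIs F p →
        Σ (HPoly r) λ h → Σ Carrier λ a → Monic h × IsGcd Y h p
          × ¬ (a ≈ 0#) × ¬ ((Y *ₚ Y) ∣ₚ ((a ·ₚ p) -ₚ (X *ₚ h)))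
          × F ≈F ((X *ₚ h) -ₚ (a ·ₚ p)) / (Y *ₚ h))
      × ((h : HPoly r) → (a : Carrier) → Monic h → IsGcd Y h p
          → ¬ (a ≈ 0#) → ¬ ((Y *ₚ Y) ∣ₚ ((a ·ₚ p) -ₚ (X *ₚ h))) →
        Σ (RatFun r) λ F → FixDivIs F p
          × F ≈F ((X *ₚ h) -ₚ (a ·ₚ p)) / (Y *ₚ h)))
proposition2p6 𝕜 (suc r′) (s≤s z≤n) p p-monic =
  (λ Y∤p → forward₁ Y∤p , backward₁ Y∤p) , (λ Y∣p → forward₂ Y∣p , backward₂ Y∣p)
  where open FixedPoints.Parametrisation 𝕜 r′ p p-monic
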